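{- Let $G_1$ and $G_2$ be graphs with $n_1$ and $n_2$ vertices respectively, let $t$ be a positive integer, and let $G$ be a $t$-connected sum of $G_1$ and $G_2$. Then for every nonnegative integer $k$, $$b_k(G)=\sum_{i=0}^k\left(b_i(G_1)\binom{n_2-t}{k-i}+b_i(G_2)\binom{n_1-t}{k-i}\right)+\binom{n_1+n_2-2t}{k}.$$
   Context: All graphs are simple. For a graph $G$ with vertex set $V$ and $W\subset V$, $G|_W$ is the induced subgraph on $W$, and $\mathrm{nc}(G|_W)$ is its number of connected components (so $\mathrm{nc}(G|_\emptyset)=0$). Define $b_k(G)=\sum_{W\subset V,\,|W|=k}(\mathrm{nc}(G|_W)-1)$ (so $b_0(G)=-1$ and $b_k(G)=0$ for $k>|V|$). Connected sum of graphs: let $G_1,G_2$ be graphs with vertex sets $V_1,V_2$ and edge sets $E_1,E_2$; let $F_1\subset V_1$, $F_2\subset V_2$ with $|F_1|=|F_2|=t$ such that $G_1|_{F_1}$ and $G_2|_{F_2}$ are complete graphs; let $\sigma:V_2\to V_2'$ be a bijection onto a finite set $V_2'$ with $V_1\cap V_2'=F_1$ and $\sigma(F_2)=F_1$. The graph with vertex set $V_1\cup V_2'$ and edge set $E_1\cup\{\{\sigma(x),\sigma(y)\}:\{x,y\}\in E_2\}$ is called a $t$-connected sum of $G_1$ and $G_2$. -}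

module Defs where

open import Data.Bool using (Bool; true; false; _∧_; _∨_; not; T)
open import Data.Nat using (ℕ; zero; suc; _<_; _≟_)
open import Data.Fin as Fin using (Fin)
open import Data.Fin.Subset using (Subset; inside; outside; ∣_∣; _∈_)
open import Data.Vec using (Vec; []; _∷_; lookup)
open import Data.List using (List; []; _∷_; _++_; map; allFin; filter; length)
open import Data.Bool.ListAction using (any; all)
open import Data.Integer as ℤ using (ℤ; +_)
open import Data.Product using (Σ; _×_; ∃; ∃-syntax)
open import Data.Sum using (_⊎_)
open import Relation.Nullary.Decidable using (⌊_⌋)
open import Relation.Binary.PropositionalEquality using (_≡_; _≢_)
open import Function.Definitions using (Injective)

record Graph (n : ℕ) : Set where
  field
    adj    : Fin n → Fin n → Bool
    sym    : ∀ x y → adj x y ≡ adj y x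
    irrefl : ∀ x → adj x x ≡ false
open Graph public

-- reach G W m u v : there is a walk u = w₀, w₁, …, wⱼ = v with j ≤ m,
-- all of whose vertices lie in W, consecutive vertices adjacent in G.
reach : ∀ {n} → Graph n → Subset n → ℕ → Fin n → Fin n → Bool
reach G W zero    u v = lookup W u ∧ ⌊ u Fin.≟ v ⌋
reach {n} G W (suc m) u v =
  reach G W m u v ∨ any (λ w → reach G W m u w ∧ (lookup W v ∧ adj G w v)) (allFin n)

-- u and v are in the same connected component of the induced subgraph G|_W
-- (any walk can be shortened to a path with at most n - 1 ≤ n edges).
connectedIn : ∀ {n} → Graph n → Subset n → Fin n → Fin n → Bool
connectedIn {n} G W u v = reach G W n u v

-- number of connected components of G|_W: each component is counted once,
-- via its vertex of least index.
nc : ∀ {n} → Graph n → Subset n → ℕ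
nc {n} G W = length (filter (λ v → T? (lookup W v ∧ isLeast v)) (allFin n))
  where
  open import Data.Bool using (T?)
  isLeast : Fin n → Bool
  isLeast v = all (λ u → not (⌊ Fin.toℕ u Data.Nat.<? Fin.toℕ v ⌋ ∧ connectedIn G W u v)) (allFin n)

allSubsets : ∀ n → List (Subset n)
allSubsets zero    = [] ∷ []
allSubsets (suc n) = map (inside ∷_) (allSubsets n) ++ map (outside ∷_) (allSubsets n)

b : ∀ {n} → ℕ → Graph n → ℤ
b {n} k G = Data.List.foldr ℤ._+_ (+ 0)
  (map (λ W → (+ nc G W) ℤ.- (+ 1)) (filter (λ W → ∣ W ∣ ≟ k) (allSubsets n)))

sumTo : ℕ → (ℕ → ℤ) → ℤ
sumTo zero    f = f 0
sumTo (suc k) f = sumTo k f ℤ.+ f (suc k)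

-- The vertex set of G is identified with
-- V₁ ∪ V₂' via the injections ι₁ (the inclusion of V₁) and ι₂ (= σ).
record IsConnectedSum {n₁ n₂ m : ℕ} (t : ℕ)
    (G₁ : Graph n₁) (G₂ : Graph n₂) (G : Graph m)
    (F₁ : Subset n₁) (F₂ : Subset n₂)
    (ι₁ : Fin n₁ → Fin m) (ι₂ : Fin n₂ → Fin m) : Set where
  field
    card₁     : ∣ F₁ ∣ ≡ t
    card₂     : ∣ F₂ ∣ ≡ t
    complete₁ : ∀ x y → x ∈ F₁ → y ∈ F₁ → x ≢ y → adj G₁ x y ≡ true
    complete₂ : ∀ x y → x ∈ F₂ → y ∈ F₂ → x ≢ y → adj G₂ x y ≡ true
    ι₁-inj    : Injective _≡_ _≡_ ι₁
    ι₂-inj    : Injective _≡_ _≡_ ι₂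
    cover     : ∀ v → (∃[ x ] ι₁ x ≡ v) ⊎ (∃[ y ] ι₂ y ≡ v)
    meet      : ∀ x y → ι₁ x ≡ ι₂ y → x ∈ F₁
    -- σ(F₂) ⊆ F₁ (equality follows from |F₁| = |F₂| and injectivity)
    glue      : ∀ y → y ∈ F₂ → ∃[ x ] (x ∈ F₁ × ι₂ y ≡ ι₁ x)
    edge⇒     : ∀ u v → adj G u v ≡ true →
                  (∃[ x ] ∃[ y ] (ι₁ x ≡ u × ι₁ y ≡ v × adj G₁ x y ≡ true))
                ⊎ (∃[ x ] ∃[ y ] (ι₂ x ≡ u × ι₂ y ≡ v × adj G₂ x y ≡ true))
    edge₁     : ∀ x y → adj G₁ x y ≡ true → adj G (ι₁ x) (ι₁ y) ≡ true
    edge₂     : ∀ x y → adj G₂ x y ≡ true → adj G (ι₂ x) (ι₂ y) ≡ true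

module Submission where

-- Write d(H,W) = nc(H|_W) - 1, so that b_k(H) = Σ_{|W|=k} d(H,W).  Let G be a
-- t-connected sum of G₁ and G₂ glued along the cliques F₁ ≅ F₂, and for
-- W ⊆ V(G) let W₁ = ι₁⁻¹(W) and W₂ = ι₂⁻¹(W).  The heart of the proof is the
-- component count
--     nc(G|_W) = nc(G₁|_W₁) + nc(G₂|_W₂) - [W₂ meets F₂],
-- since a walk of G|_W can only pass between the sides through the clique, and
-- the clique lies inside one component on each side.  Equivalently
--     d(G,W) = d(G₁,W₁) + d(G₂,W₂) + [W₂ avoids F₂].
-- Summing over |W| = k and parametrising W by the pair (W₁, X) with X ⊆ V₂
-- avoiding F₂, each of the three sums becomes a binomial convolution:
-- Σ_i b_i(G₁)·C(n₂-t, k-i), the symmetric term for G₂, and the number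
-- C(n₁+n₂-2t, k) of k-sets avoiding both cliques.

module Booleans where

  open import Data.Bool using (Bool; true; false; not; _∧_; _∨_)
  open import Data.Bool.ListAction using (any; all)
  open import Data.Fin as Fin using (Fin)
  open import Data.List using (List; []; _∷_)
  open import Data.List.Membership.Propositional using (_∈_)
  open import Data.List.Relation.Unary.Any using (here; there)
  open import Data.Product using (_×_; _,_; ∃-syntax)
  open import Data.Sum using (_⊎_; inj₁; inj₂)
  open import Relation.Nullary using (yes; no)
  open import Relation.Nullary.Decidable using (⌊_⌋)
  open import Relation.Binary.PropositionalEquality
  open import Data.Empty using (⊥-elim)

  t≢f : true ≢ false
  t≢f ()

  ∧-intro : ∀ {a b} → a ≡ true → b ≡ true → a ∧ b ≡ true
  ∧-intro refl refl = refl

  ∧-elim : ∀ {a b} → a ∧ b ≡ true → a ≡ true × b ≡ true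
  ∧-elim {true} {true} e = refl , refl

  ∨-elim : ∀ {a b} → a ∨ b ≡ true → a ≡ true ⊎ b ≡ true
  ∨-elim {true}  e = inj₁ refl
  ∨-elim {false} e = inj₂ e

  not-true : ∀ {b} → not b ≡ true → b ≡ false
  not-true {false} _ = refl

  not-intro : ∀ {b} → b ≡ false → not b ≡ true
  not-intro refl = refl

  ≟-true : ∀ {n} (u v : Fin n) → ⌊ u Fin.≟ v ⌋ ≡ true → u ≡ v
  ≟-true u v e with u Fin.≟ v
  ... | yes p = p

  ≟-refl : ∀ {n} (u : Fin n) → ⌊ u Fin.≟ u ⌋ ≡ true
  ≟-refl u with u Fin.≟ u
  ... | yes _ = refl
  ... | no ¬p = ⊥-elim (¬p refl)

  module _ {X : Set} where
    any-elim : ∀ (p : X → Bool) xs → any p xs ≡ true → ∃[ x ] (x ∈ xs × p x ≡ true)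
    any-elim p (x ∷ xs) e with p x in px
    ... | true  = x , here refl , px
    ... | false = let (y , y∈ , py) = any-elim p xs e in y , there y∈ , py

    any-intro : ∀ (p : X → Bool) xs x → x ∈ xs → p x ≡ true → any p xs ≡ true
    any-intro p (y ∷ xs) x (here refl) e rewrite e = refl
    any-intro p (y ∷ xs) x (there x∈) e with p y
    ... | true  = refl
    ... | false = any-intro p xs x x∈ e

    any-cong : ∀ (p q : X → Bool) xs → (∀ x → p x ≡ q x) → any p xs ≡ any q xs
    any-cong p q []       e = refl
    any-cong p q (x ∷ xs) e = cong₂ _∨_ (e x) (any-cong p q xs e)

    all-elim : ∀ (p : X → Bool) xs → all p xs ≡ true → ∀ x → x ∈ xs → p x ≡ true
    all-elim p (y ∷ xs) e x (here refl) with p y in py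
    ... | true = refl
    all-elim p (y ∷ xs) e x (there x∈) with p y
    ... | true = all-elim p xs e x x∈

    all-intro : ∀ (p : X → Bool) xs → (∀ x → x ∈ xs → p x ≡ true) → all p xs ≡ true
    all-intro p []       h = refl
    all-intro p (y ∷ xs) h rewrite h y (here refl) = all-intro p xs (λ x x∈ → h x (there x∈))

module Sums where

  open import Data.Bool using (Bool; true; false; not; _∧_; _∨_; T?)
  open import Data.Nat using (z≤n; s≤s)
  open import Data.Integer as ℤ using (ℤ; +_; 0ℤ; 1ℤ; _+_; _*_; _≤_; _<_)
  open import Data.Integer.Properties as ℤP
  open import Data.List using (List; []; _∷_; _++_; map; foldr; filter; length)
  open import Data.List.Membership.Propositional using (_∈_)
  open import Data.List.Relation.Unary.Any using (here; there)
  open import Data.List.Relation.Unary.Unique.Propositional using (Unique)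
  open import Data.List.Relation.Unary.AllPairs using (_∷_)
  import Data.List.Relation.Unary.All as All
  open import Relation.Nullary using (yes; no)
  open import Relation.Nullary.Decidable using (⌊_⌋)
  open import Relation.Unary using (Decidable)
  open import Relation.Binary.PropositionalEquality
  open import Data.Empty using (⊥-elim)
  open import Data.Product using (_×_; _,_; proj₁; proj₂; ∃-syntax)
  open import Data.Integer.Tactic.RingSolver

  Σ : {X : Set} → List X → (X → ℤ) → ℤ
  Σ []       f = 0ℤ
  Σ (x ∷ xs) f = f x + Σ xs f

  _⇒_ : Bool → ℤ → ℤ
  true  ⇒ v = v
  false ⇒ v = 0ℤ
  infixr 5 _⇒_

  𝟙 : Bool → ℤ
  𝟙 b = b ⇒ 1ℤ

  ⇒-+ : ∀ b u v → b ⇒ (u + v) ≡ (b ⇒ u) + (b ⇒ v)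
  ⇒-+ true  u v = refl
  ⇒-+ false u v = refl

  ⇒0 : ∀ b → (b ⇒ 0ℤ) ≡ 0ℤ
  ⇒0 true  = refl
  ⇒0 false = refl

  split⇒ : ∀ b v → v ≡ (b ⇒ v) + (not b ⇒ v)
  split⇒ true  v = sym (+-identityʳ v)
  split⇒ false v = sym (+-identityˡ v)

  𝟙-∨ : ∀ a b → (a ≡ true → b ≡ true → Data.Empty.⊥) → 𝟙 (a ∨ b) ≡ 𝟙 a + 𝟙 b
  𝟙-∨ true  true  h = ⊥-elim (h refl refl)
  𝟙-∨ true  false h = refl
  𝟙-∨ false b     h = sym (+-identityˡ _)

  𝟙-split : ∀ a b → 𝟙 a ≡ 𝟙 (a ∧ not b) + 𝟙 (a ∧ b)
  𝟙-split true  true  = refl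
  𝟙-split true  false = refl
  𝟙-split false b     = refl

  𝟙≥0 : ∀ b → 0ℤ ≤ 𝟙 b
  𝟙≥0 true  = ℤ.+≤+ z≤n
  𝟙≥0 false = ≤-refl

  𝟙≤1 : ∀ b → 𝟙 b ≤ 1ℤ
  𝟙≤1 true  = ≤-refl
  𝟙≤1 false = ℤ.+≤+ z≤n

  𝟙-mono : ∀ {a b} → (a ≡ true → b ≡ true) → 𝟙 a ≤ 𝟙 b
  𝟙-mono {false} {b} h = 𝟙≥0 b
  𝟙-mono {true}  {b} h rewrite h refl = ≤-refl

  𝟙-strict : ∀ a b → (a ≡ true → b ≡ true) → b ≢ a → 𝟙 a < 𝟙 b
  𝟙-strict false true  h ne = ℤ.+<+ (s≤s z≤n)
  𝟙-strict false false h ne = ⊥-elim (ne refl)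
  𝟙-strict true  true  h ne = ⊥-elim (ne refl)
  𝟙-strict true  false h ne with () ← h refl

  module _ {X : Set} where
    Σ-cong : ∀ (xs : List X) {f g : X → ℤ} → (∀ x → f x ≡ g x) → Σ xs f ≡ Σ xs g
    Σ-cong []       e = refl
    Σ-cong (x ∷ xs) e = cong₂ _+_ (e x) (Σ-cong xs e)

    Σ-cong∈ : ∀ (xs : List X) {f g : X → ℤ} → (∀ x → x ∈ xs → f x ≡ g x) → Σ xs f ≡ Σ xs g
    Σ-cong∈ []       e = refl
    Σ-cong∈ (x ∷ xs) e = cong₂ _+_ (e x (here refl)) (Σ-cong∈ xs (λ y y∈ → e y (there y∈)))

    Σ-0 : ∀ (xs : List X) → Σ xs (λ _ → 0ℤ) ≡ 0ℤ
    Σ-0 []       = refl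
    Σ-0 (x ∷ xs) = trans (+-identityˡ _) (Σ-0 xs)

    Σ-zero : ∀ (xs : List X) {f : X → ℤ} → (∀ x → x ∈ xs → f x ≡ 0ℤ) → Σ xs f ≡ 0ℤ
    Σ-zero xs e = trans (Σ-cong∈ xs e) (Σ-0 xs)

    Σ-+ : ∀ (xs : List X) (f g : X → ℤ) → Σ xs (λ x → f x + g x) ≡ Σ xs f + Σ xs g
    Σ-+ []       f g = refl
    Σ-+ (x ∷ xs) f g = trans (cong (_+_ (f x + g x)) (Σ-+ xs f g)) (swap4 (f x) (g x) (Σ xs f) (Σ xs g))
      where
      swap4 : ∀ a b c d → (a + b) + (c + d) ≡ (a + c) + (b + d)
      swap4 = solve-∀

    Σ-*ˡ : ∀ (xs : List X) (c : ℤ) (f : X → ℤ) → Σ xs (λ x → c * f x) ≡ c * Σ xs f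
    Σ-*ˡ []       c f = sym (*-zeroʳ c)
    Σ-*ˡ (x ∷ xs) c f = trans (cong (_+_ (c * f x)) (Σ-*ˡ xs c f)) (sym (*-distribˡ-+ c (f x) (Σ xs f)))

    Σ-++ : ∀ (xs ys : List X) (f : X → ℤ) → Σ (xs ++ ys) f ≡ Σ xs f + Σ ys f
    Σ-++ []       ys f = sym (+-identityˡ _)
    Σ-++ (x ∷ xs) ys f = trans (cong (_+_ (f x)) (Σ-++ xs ys f)) (sym (+-assoc (f x) _ _))

  module _ {X Y : Set} where
    Σ-map : ∀ (h : X → Y) (xs : List X) (f : Y → ℤ) → Σ (map h xs) f ≡ Σ xs (λ x → f (h x))
    Σ-map h []       f = refl
    Σ-map h (x ∷ xs) f = cong (_+_ (f (h x))) (Σ-map h xs f)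

    Σ-swap : ∀ (xs : List X) (ys : List Y) (f : X → Y → ℤ) →
             Σ xs (λ x → Σ ys (λ y → f x y)) ≡ Σ ys (λ y → Σ xs (λ x → f x y))
    Σ-swap []       ys f = sym (Σ-0 ys)
    Σ-swap (x ∷ xs) ys f = trans (cong (_+_ (Σ ys (f x))) (Σ-swap xs ys f))
                                 (sym (Σ-+ ys (f x) (λ y → Σ xs (λ x′ → f x′ y))))

    Σ-prod : ∀ (xs : List X) (ys : List Y) (f : X → ℤ) (g : Y → ℤ) →
             Σ xs f * Σ ys g ≡ Σ xs (λ x → Σ ys (λ y → f x * g y))
    Σ-prod xs ys f g = trans (ℤP.*-comm (Σ xs f) (Σ ys g))
      (trans (sym (Σ-*ˡ xs (Σ ys g) f))
      (Σ-cong xs (λ x → trans (ℤP.*-comm (Σ ys g) (f x)) (sym (Σ-*ˡ ys (f x) g)))))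

  +-≤-equal : ∀ {a b c d} → a ≤ b → c ≤ d → a + c ≡ b + d → a ≡ b × c ≡ d
  +-≤-equal {a} {b} {c} {d} a≤b c≤d e with a ℤ.≟ b | c ℤ.≟ d
  ... | yes p | yes q = p , q
  ... | no ¬p | _ = ⊥-elim (ℤP.<-irrefl e (ℤP.+-mono-<-≤ (ℤP.≤∧≢⇒< a≤b ¬p) c≤d))
  ... | yes p | no ¬q = ⊥-elim (ℤP.<-irrefl e (ℤP.+-mono-≤-< a≤b (ℤP.≤∧≢⇒< c≤d ¬q)))

  module _ {X : Set} where
    Σ-unique : ∀ (xs : List X) → Unique xs → (P : X → Bool) (h : X → ℤ) (a : X) →
               a ∈ xs → P a ≡ true → (∀ x → x ∈ xs → P x ≡ true → x ≡ a) →
               Σ xs (λ x → P x ⇒ h x) ≡ h a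
    Σ-unique (x ∷ xs) (x∉ ∷ u) P h a (here refl) Pa uniq
      rewrite Pa = trans (cong (_+_ (h x)) (Σ-zero xs rest)) (+-identityʳ (h x))
      where
      rest : ∀ y → y ∈ xs → (P y ⇒ h y) ≡ 0ℤ
      rest y y∈ with P y in eq
      ... | false = refl
      ... | true  = ⊥-elim (All.lookup x∉ y∈ (sym (uniq y (there y∈) eq)))
    Σ-unique (x ∷ xs) (x∉ ∷ u) P h a (there a∈) Pa uniq with P x in eq
    ... | true  = ⊥-elim (All.lookup x∉ a∈ (uniq x (here refl) eq))
    ... | false = trans (+-identityˡ _) (Σ-unique xs u P h a a∈ Pa (λ y y∈ → uniq y (there y∈)))

    length-filter : ∀ (p : X → Bool) (xs : List X) →
                    + length (filter (λ x → T? (p x)) xs) ≡ Σ xs (λ x → 𝟙 (p x))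
    length-filter p []       = refl
    length-filter p (x ∷ xs) with p x
    ... | true  = trans (sym (ℤP.pos-+ 1 _)) (cong (_+_ (1ℤ)) (length-filter p xs))
    ... | false = trans (length-filter p xs) (sym (+-identityˡ _))

    foldr-filter : ∀ {P : X → Set} (P? : Decidable P) (g : X → ℤ) (xs : List X) →
                   foldr _+_ 0ℤ (map g (filter P? xs)) ≡ Σ xs (λ x → ⌊ P? x ⌋ ⇒ g x)
    foldr-filter P? g []       = refl
    foldr-filter P? g (x ∷ xs) with P? x
    ... | yes _ = cong (_+_ (g x)) (foldr-filter P? g xs)
    ... | no _  = trans (foldr-filter P? g xs) (sym (+-identityˡ _))

    Σ-mono : ∀ (xs : List X) {f g : X → ℤ} → (∀ x → f x ≤ g x) → Σ xs f ≤ Σ xs g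
    Σ-mono []       le = ℤP.≤-refl
    Σ-mono (x ∷ xs) le = ℤP.+-mono-≤ (le x) (Σ-mono xs le)

    Σ-≤-equal : ∀ (xs : List X) {f g : X → ℤ} → (∀ x → f x ≤ g x) → Σ xs f ≡ Σ xs g →
                ∀ x → x ∈ xs → f x ≡ g x
    Σ-≤-equal (y ∷ xs) le eq x (here refl) = proj₁ (+-≤-equal (le y) (Σ-mono xs le) eq)
    Σ-≤-equal (y ∷ xs) le eq x (there x∈) = Σ-≤-equal xs le (proj₂ (+-≤-equal (le y) (Σ-mono xs le) eq)) x x∈

    Σ-nonneg : ∀ (xs : List X) (f : X → ℤ) → (∀ x → 0ℤ ≤ f x) → 0ℤ ≤ Σ xs f
    Σ-nonneg []       f nn = ℤP.≤-refl
    Σ-nonneg (z ∷ zs) f nn = ℤP.+-mono-≤ (nn z) (Σ-nonneg zs f nn)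

    Σ-elem-≤ : ∀ (xs : List X) (f : X → ℤ) → (∀ x → 0ℤ ≤ f x) → ∀ x → x ∈ xs → f x ≤ Σ xs f
    Σ-elem-≤ (y ∷ xs) f nn x (here refl) =
      ℤP.≤-trans (ℤP.≤-reflexive (sym (ℤP.+-identityʳ (f y)))) (ℤP.+-monoʳ-≤ (f y) (Σ-nonneg xs f nn))
    Σ-elem-≤ (y ∷ xs) f nn x (there x∈) =
      ℤP.≤-trans (Σ-elem-≤ xs f nn x x∈) (ℤP.≤-trans (ℤP.≤-reflexive (sym (ℤP.+-identityˡ _))) (ℤP.+-monoˡ-≤ (Σ xs f) (nn y)))

    Σ-strict : ∀ (xs : List X) (f g : X → ℤ) → (∀ x → f x ≤ g x) → ∀ x → x ∈ xs → f x < g x → Σ xs f < Σ xs g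
    Σ-strict (y ∷ xs) f g le x (here refl) lt = ℤP.+-mono-<-≤ lt (Σ-mono xs le)
    Σ-strict (y ∷ xs) f g le x (there x∈) lt = ℤP.+-mono-≤-< (le y) (Σ-strict xs f g le x x∈ lt)

  module _ {X Y : Set} where
    Σ-matching : (xs : List X) (ys : List Y) → Unique xs → Unique ys →
      (P : X → Bool) (Q : Y → Bool) (R : X → Y → Bool) (f : X → ℤ) (g : Y → ℤ) →
      (∀ x → x ∈ xs → P x ≡ true → ∃[ y ] (y ∈ ys × R x y ≡ true × (∀ y′ → y′ ∈ ys → R x y′ ≡ true → y′ ≡ y))) →
      (∀ y → y ∈ ys → Q y ≡ true → ∃[ x ] (x ∈ xs × R x y ≡ true × (∀ x′ → x′ ∈ xs → R x′ y ≡ true → x′ ≡ x))) →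
      (∀ x y → R x y ≡ true → P x ≡ true × Q y ≡ true × f x ≡ g y) →
      Σ xs (λ x → P x ⇒ f x) ≡ Σ ys (λ y → Q y ⇒ g y)
    Σ-matching xs ys ux uy P Q R f g hx hy hR =
      trans (Σ-cong∈ xs expand-x)
      (trans (Σ-swap xs ys (λ x y → R x y ⇒ f x))
      (trans (Σ-cong ys (λ y → Σ-cong xs (λ x → transport x y)))
             (sym (Σ-cong∈ ys expand-y))))
      where
      transport : ∀ x y → (R x y ⇒ f x) ≡ (R x y ⇒ g y)
      transport x y with R x y in e
      ... | true  = proj₂ (proj₂ (hR x y e))
      ... | false = refl
      expand-x : ∀ x → x ∈ xs → (P x ⇒ f x) ≡ Σ ys (λ y → R x y ⇒ f x)
      expand-x x x∈ with P x in e
      ... | true  = let (y , y∈ , r , u) = hx x x∈ e in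
                    sym (Σ-unique ys uy (R x) (λ _ → f x) y y∈ r u)
      ... | false = sym (Σ-zero ys (λ y _ → no-match y))
        where
        no-match : ∀ y → (R x y ⇒ f x) ≡ 0ℤ
        no-match y with R x y in e′
        ... | false = refl
        ... | true  with () ← trans (sym e) (proj₁ (hR x y e′))
      expand-y : ∀ y → y ∈ ys → (Q y ⇒ g y) ≡ Σ xs (λ x → R x y ⇒ g y)
      expand-y y y∈ with Q y in e
      ... | true  = let (x , x∈ , r , u) = hy y y∈ e in
                    sym (Σ-unique xs ux (λ x → R x y) (λ _ → g y) x x∈ r u)
      ... | false = sym (Σ-zero xs (λ x _ → no-match x))
        where
        no-match : ∀ x → (R x y ⇒ g y) ≡ 0ℤ
        no-match x with R x y in e′
        ... | false = refl
        ... | true  with () ← trans (sym e) (proj₁ (proj₂ (hR x y e′)))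

module Subsets where

  open Sums
  open import Defs using (allSubsets)
  open import Data.Bool using (Bool; true; false; not; _∧_; T)
  open import Data.Nat as ℕ using (ℕ; zero; suc; _≡ᵇ_; _∸_)
  import Data.Nat.Properties as ℕP
  open import Data.Nat.Combinatorics using (_C_; nCk+nC[k+1]≡[n+1]C[k+1])
  open import Data.Integer as ℤ using (ℤ; +_; 0ℤ; 1ℤ; _+_)
  open import Data.Integer.Properties as ℤP using (+-identityʳ; +-identityˡ)
  open import Data.Fin using (Fin; zero; suc)
  open import Data.Fin.Subset using (Subset; inside; outside; ∣_∣)
  open import Data.Fin.Subset.Properties using (∣p∣≤n)
  import Data.Vec
  open import Data.Vec using ([]; _∷_; lookup)
  open import Data.List using (List; []; _∷_; map; allFin; cartesianProduct; tabulate)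
  open import Data.List.Membership.Propositional using (_∈_)
  open import Data.List.Membership.Propositional.Properties using (∈-map⁺; ∈-map⁻; ∈-++⁺ˡ; ∈-++⁺ʳ)
  open import Data.List.Relation.Unary.Any using (here)
  import Data.List.Relation.Unary.AllPairs as AP
  import Data.List.Relation.Unary.All as All
  open import Data.List.Relation.Unary.Unique.Propositional using (Unique)
  open import Data.List.Relation.Unary.Unique.Propositional.Properties using (map⁺; ++⁺)
  open import Data.List.Relation.Binary.Disjoint.Propositional using (Disjoint)
  open import Data.Product using (_×_; _,_; ∃)
  open import Relation.Nullary using (Dec; yes; no)
  open import Relation.Nullary.Decidable using (⌊_⌋)
  open import Relation.Binary.PropositionalEquality
  open import Data.Empty using (⊥-elim)
  open import Data.Unit using (tt)

  isYes≡ᵇ : ∀ m n (d : Dec (m ≡ n)) → ⌊ d ⌋ ≡ (m ≡ᵇ n)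
  isYes≡ᵇ m n d with d | m ≡ᵇ n in e
  ... | yes p | true  = refl
  ... | no ¬p | false = refl
  ... | yes p | false = ⊥-elim (subst T e (ℕP.≡⇒≡ᵇ m n p))
  ... | no ¬p | true  = ⊥-elim (¬p (ℕP.≡ᵇ⇒≡ m n (subst T (sym e) tt)))

  ≡ᵇ-refl : ∀ n → (n ≡ᵇ n) ≡ true
  ≡ᵇ-refl zero    = refl
  ≡ᵇ-refl (suc n) = ≡ᵇ-refl n

  ≡ᵇ-true : ∀ m n → (m ≡ᵇ n) ≡ true → m ≡ n
  ≡ᵇ-true m n e = ℕP.≡ᵇ⇒≡ m n (subst T (sym e) tt)

  ≡ᵇ-false : ∀ m n → m ≢ n → (m ≡ᵇ n) ≡ false
  ≡ᵇ-false m n ne with m ≡ᵇ n in e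
  ... | false = refl
  ... | true  = ⊥-elim (ne (≡ᵇ-true m n e))

  allSubsets-unique : ∀ n → Unique (allSubsets n)
  allSubsets-unique zero    = All.[] AP.∷ AP.[]
  allSubsets-unique (suc n) =
    ++⁺ (map⁺ (λ { refl → refl }) (allSubsets-unique n))
        (map⁺ (λ { refl → refl }) (allSubsets-unique n))
        disj
    where
    disj : Disjoint (map (inside ∷_) (allSubsets n)) (map (outside ∷_) (allSubsets n))
    disj (p , q) with ∈-map⁻ (inside ∷_) p | ∈-map⁻ (outside ∷_) q
    ... | (a , _ , refl) | (b , _ , ())

  ∈-allSubsets : ∀ {n} (W : Subset n) → W ∈ allSubsets n
  ∈-allSubsets []           = here refl
  ∈-allSubsets (true ∷ W)  = ∈-++⁺ˡ (∈-map⁺ (inside ∷_) (∈-allSubsets W))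
  ∈-allSubsets (false ∷ W) = ∈-++⁺ʳ (map (inside ∷_) (allSubsets _)) (∈-map⁺ (outside ∷_) (∈-allSubsets W))

  Σ-allSubsets-suc : ∀ n (f : Subset (suc n) → ℤ) →
    Σ (allSubsets (suc n)) f ≡ Σ (allSubsets n) (λ W → f (inside ∷ W)) + Σ (allSubsets n) (λ W → f (outside ∷ W))
  Σ-allSubsets-suc n f = trans (Σ-++ (map (inside ∷_) (allSubsets n)) _ f)
    (cong₂ _+_ (Σ-map (inside ∷_) (allSubsets n) f) (Σ-map (outside ∷_) (allSubsets n) f))

  Σ-tabulate : ∀ {X : Set} n (g : Fin n → X) (f : X → ℤ) → Σ (tabulate g) f ≡ Σ (allFin n) (λ i → f (g i))
  Σ-tabulate zero    g f = refl
  Σ-tabulate (suc n) g f = cong (_+_ (f (g zero)))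
    (trans (Σ-tabulate n (λ i → g (suc i)) f) (sym (Σ-tabulate n suc (λ i → f (g i)))))

  Σ-allFin-suc : ∀ n (f : Fin (suc n) → ℤ) → Σ (allFin (suc n)) f ≡ f zero + Σ (allFin n) (λ i → f (suc i))
  Σ-allFin-suc n f = cong (_+_ (f zero)) (Σ-tabulate n suc f)

  Σ-ones : ∀ n → Σ (allFin n) (λ _ → 1ℤ) ≡ + n
  Σ-ones zero    = refl
  Σ-ones (suc n) = trans (Σ-allFin-suc n (λ _ → 1ℤ)) (trans (cong (_+_ 1ℤ) (Σ-ones n)) (sym (ℤP.pos-+ 1 n)))

  card-Σ : ∀ {n} (W : Subset n) → + ∣ W ∣ ≡ Σ (allFin n) (λ v → 𝟙 (lookup W v))
  card-Σ []          = refl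
  card-Σ {suc n} (true ∷ W)  = trans (ℤP.pos-+ 1 ∣ W ∣)
    (trans (cong (_+_ 1ℤ) (card-Σ W)) (sym (Σ-allFin-suc n (λ v → 𝟙 (lookup (true ∷ W) v)))))
  card-Σ {suc n} (false ∷ W) = trans (card-Σ W)
    (trans (sym (+-identityˡ _)) (sym (Σ-allFin-suc n (λ v → 𝟙 (lookup (false ∷ W) v)))))

  preimage : ∀ {a n} → (Fin a → Fin n) → Subset n → Subset a
  preimage ι W = Data.Vec.tabulate (λ x → lookup W (ι x))

  Σ-cartesianProduct : ∀ {X Y : Set} (xs : List X) (ys : List Y) (f : X × Y → ℤ) →
    Σ (cartesianProduct xs ys) f ≡ Σ xs (λ x → Σ ys (λ y → f (x , y)))
  Σ-cartesianProduct []       ys f = refl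
  Σ-cartesianProduct (x ∷ xs) ys f = trans (Σ-++ (map (x ,_) ys) _ f)
    (cong₂ _+_ (Σ-map (x ,_) ys f) (Σ-cartesianProduct xs ys f))

  avoids : ∀ {n} → Subset n → Subset n → Bool
  avoids []      []      = true
  avoids (f ∷ F) (x ∷ X) = not (f ∧ x) ∧ avoids F X

  avoids-sound : ∀ {n} (F X : Subset n) → avoids F X ≡ true → ∀ i → lookup F i ≡ true → lookup X i ≡ false
  avoids-sound (true ∷ F)  (false ∷ X) e zero    p = refl
  avoids-sound (true ∷ F)  (true ∷ X)  () zero p
  avoids-sound (true ∷ F)  (false ∷ X) e (suc i) p = avoids-sound F X e i p
  avoids-sound (false ∷ F) (x ∷ X)     e (suc i) p = avoids-sound F X e i p
  avoids-sound (true ∷ F)  (true ∷ X)  () (suc i) p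

  avoids-complete : ∀ {n} (F X : Subset n) → (∀ i → lookup F i ≡ true → lookup X i ≡ false) → avoids F X ≡ true
  avoids-complete []          []          h = refl
  avoids-complete (true ∷ F)  (true ∷ X)  h with () ← h zero refl
  avoids-complete (true ∷ F)  (false ∷ X) h = avoids-complete F X (λ i → h (suc i))
  avoids-complete (false ∷ F) (x ∷ X)     h = avoids-complete F X (λ i → h (suc i))

  avoids-false : ∀ {n} (F X : Subset n) → avoids F X ≡ false → ∃ λ i → lookup F i ≡ true × lookup X i ≡ true
  avoids-false [] [] ()
  avoids-false (true ∷ F) (true ∷ X) e = zero , refl , refl
  avoids-false (true ∷ F) (false ∷ X) e = let (i , p , q) = avoids-false F X e in suc i , p , q
  avoids-false (false ∷ F) (x ∷ X) e = let (i , p , q) = avoids-false F X e in suc i , p , q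

  suc∸∣∣ : ∀ {n} (F : Subset n) → suc n ∸ ∣ F ∣ ≡ suc (n ∸ ∣ F ∣)
  suc∸∣∣ F = ℕP.+-∸-assoc 1 (∣p∣≤n F)

  count-avoiding : ∀ n (F : Subset n) (k : ℕ) →
    Σ (allSubsets n) (λ X → avoids F X ⇒ 𝟙 (∣ X ∣ ≡ᵇ k)) ≡ + ((n ∸ ∣ F ∣) C k)
  count-avoiding zero    []         zero    = refl
  count-avoiding zero    []         (suc k) = refl
  count-avoiding (suc n) (true ∷ F) k = trans (Σ-allSubsets-suc n _)
    (trans (cong₂ _+_ (Σ-0 (allSubsets n)) (count-avoiding n F k)) (+-identityˡ _))
  count-avoiding (suc n) (false ∷ F) zero = trans (Σ-allSubsets-suc n _)
    (trans (cong₂ _+_ (Σ-zero (allSubsets n) (λ X _ → ⇒0 (avoids F X))) (count-avoiding n F zero)) (+-identityˡ _))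
  count-avoiding (suc n) (false ∷ F) (suc k) = trans (Σ-allSubsets-suc n _)
    (trans (cong₂ _+_ (count-avoiding n F k) (count-avoiding n F (suc k)))
    (trans (sym (ℤP.pos-+ ((n ∸ ∣ F ∣) C k) ((n ∸ ∣ F ∣) C suc k)))
    (cong +_ (trans (nCk+nC[k+1]≡[n+1]C[k+1] (n ∸ ∣ F ∣) k) (cong (_C suc k) (sym (suc∸∣∣ F)))))))

  count-avoiding-pairs : ∀ n₁ (F₁ : Subset n₁) n₂ (F₂ : Subset n₂) (k : ℕ) →
    Σ (allSubsets n₁) (λ Y → Σ (allSubsets n₂) (λ X → avoids F₁ Y ⇒ avoids F₂ X ⇒ 𝟙 ((∣ Y ∣ ℕ.+ ∣ X ∣) ≡ᵇ k)))
    ≡ + (((n₁ ∸ ∣ F₁ ∣) ℕ.+ (n₂ ∸ ∣ F₂ ∣)) C k)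
  count-avoiding-pairs zero [] n₂ F₂ k = trans (+-identityʳ _) (count-avoiding n₂ F₂ k)
  count-avoiding-pairs (suc n) (true ∷ F) n₂ F₂ k = trans (Σ-allSubsets-suc n _)
    (trans (cong₂ _+_ (Σ-zero (allSubsets n) (λ Y _ → Σ-0 (allSubsets n₂))) (count-avoiding-pairs n F n₂ F₂ k))
           (+-identityˡ _))
  count-avoiding-pairs (suc n) (false ∷ F) n₂ F₂ zero = trans (Σ-allSubsets-suc n _)
    (trans (cong₂ _+_ (Σ-zero (allSubsets n) (λ Y _ → Σ-zero (allSubsets n₂) (λ X _ → too-big Y X)))
                      (count-avoiding-pairs n F n₂ F₂ zero))
           (+-identityˡ _))
    where
    too-big : ∀ Y X → (avoids F Y ⇒ avoids F₂ X ⇒ 𝟙 (suc (∣ Y ∣ ℕ.+ ∣ X ∣) ≡ᵇ zero)) ≡ 0ℤ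
    too-big Y X with avoids F Y | avoids F₂ X
    ... | true  | true  = refl
    ... | true  | false = refl
    ... | false | _     = refl
  count-avoiding-pairs (suc n) (false ∷ F) n₂ F₂ (suc k) = trans (Σ-allSubsets-suc n _)
    (trans (cong₂ _+_ (count-avoiding-pairs n F n₂ F₂ k) (count-avoiding-pairs n F n₂ F₂ (suc k)))
    (trans (sym (ℤP.pos-+ (N C k) (N C suc k)))
    (cong +_ (trans (nCk+nC[k+1]≡[n+1]C[k+1] N k)
      (cong (_C suc k) (cong (ℕ._+ (n₂ ∸ ∣ F₂ ∣)) (sym (suc∸∣∣ F))))))))
    where
    N : ℕ
    N = (n ∸ ∣ F ∣) ℕ.+ (n₂ ∸ ∣ F₂ ∣)

-- Connectivity in an induced subgraph H|_W.  The definition connectedIn uses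
-- walks of length at most n; we show it is the reflexive-transitive closure of
-- adjacency inside W (walks can always be shortened), hence an equivalence
-- relation on W.
module Components where

  open Sums
  open Booleans
  open Subsets using (Σ-ones)
  open import Defs hiding (sym)
  open import Data.Bool using (Bool; true; false; not; _∧_; _∨_)
  open import Data.Bool.ListAction using (any; all)
  open import Data.Nat as ℕ using (ℕ; zero; suc; _<?_)
  import Data.Nat.Properties as ℕP
  open import Data.Integer as ℤ using (ℤ; +_; 1ℤ; _≤_; _<_)
  import Data.Integer.Properties as ℤP
  open import Data.Fin as Fin using (Fin; toℕ)
  import Data.Fin.Properties as FinP
  open import Data.Fin.Subset using (Subset)
  open import Data.Vec using (lookup)
  open import Data.List using (allFin)
  open import Data.List.Membership.Propositional using (_∈_)
  open import Data.List.Membership.Propositional.Properties using (∈-allFin)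
  open import Data.List.Relation.Unary.Unique.Propositional.Properties using (allFin⁺)
  open import Data.Product using (_×_; _,_; proj₁; proj₂; ∃-syntax)
  open import Data.Sum using (_⊎_; inj₁; inj₂)
  open import Relation.Nullary using (Dec; yes; no; ¬_; _×-dec_)
  open import Relation.Nullary.Decidable using (⌊_⌋; ¬?; decidable-stable)
  import Data.Bool.Properties as BP
  open import Relation.Binary.PropositionalEquality
  open import Data.Empty using (⊥-elim)
  open import Relation.Binary using (tri<; tri≈; tri>)

  module Induced {n : ℕ} (H : Graph n) (W : Subset n) where

    Wv : Fin n → Set
    Wv v = lookup W v ≡ true

    R : ℕ → Fin n → Fin n → Bool
    R m = reach H W m

    reachW : ∀ m u v → R m u v ≡ true → Wv u × Wv v
    reachW zero u v e = wu , subst Wv (≟-true u v (proj₂ (∧-elim e))) wu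
      where wu = proj₁ (∧-elim {lookup W u} e)
    reachW (suc m) u v e with ∨-elim e
    ... | inj₁ e′ = reachW m u v e′
    ... | inj₂ e′ = let (w , _ , q) = any-elim _ (allFin n) e′
                        (r , s) = ∧-elim q
                    in proj₁ (reachW m u w r) , proj₁ (∧-elim s)

    reach-refl : ∀ {u} → Wv u → R zero u u ≡ true
    reach-refl {u} wu rewrite wu = ≟-refl u

    reach-suc : ∀ m u v → R m u v ≡ true → R (suc m) u v ≡ true
    reach-suc m u v e rewrite e = refl

    reach-≤ : ∀ {m m′} u v → m ℕ.≤ m′ → R m u v ≡ true → R m′ u v ≡ true
    reach-≤ {m} {m′} u v le e =
      subst (λ k → R k u v ≡ true) (ℕP.m∸n+n≡m le) (reach-+ (m′ ℕ.∸ m) e)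
      where
      reach-+ : ∀ i → R m u v ≡ true → R (i ℕ.+ m) u v ≡ true
      reach-+ zero    e = e
      reach-+ (suc i) e = reach-suc (i ℕ.+ m) u v (reach-+ i e)

    reach-step : ∀ m u w v → R m u w ≡ true → Wv v → adj H w v ≡ true → R (suc m) u v ≡ true
    reach-step m u w v r wv a with R m u v
    ... | true  = refl
    ... | false = any-intro _ (allFin n) w (∈-allFin w)
                    (subst (λ z → z ∧ (lookup W v ∧ adj H w v) ≡ true) (sym r)
                      (subst (λ z → z ∧ adj H w v ≡ true) (sym wv) a))

    -- Walks can be shortened: the set of vertices reachable from u in j steps
    -- grows strictly until it stabilises, and it has at most n elements.
    stable : ℕ → Fin n → Set
    stable j u = ∀ v → R (suc j) u v ≡ R j u v

    stable? : ∀ j u → Dec (stable j u)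
    stable? j u = FinP.all? (λ v → BP._≟_ (R (suc j) u v) (R j u v))

    stable-+ : ∀ j u → stable j u → ∀ i v → R (i ℕ.+ j) u v ≡ R j u v
    stable-+ j u st zero    v = refl
    stable-+ j u st (suc i) v =
      trans (cong₂ _∨_ (stable-+ j u st i v)
                       (any-cong _ _ (allFin n) (λ w → cong (_∧ (lookup W v ∧ adj H w v)) (stable-+ j u st i w))))
            (st v)

    reachCount : ℕ → Fin n → ℤ
    reachCount j u = Σ (allFin n) (λ v → 𝟙 (R j u v))

    reachCount≤n : ∀ j u → reachCount j u ≤ + n
    reachCount≤n j u = ℤP.≤-trans (Σ-mono (allFin n) (λ v → 𝟙≤1 (R j u v))) (ℤP.≤-reflexive (Σ-ones n))

    grow : ∀ j u → ¬ stable j u → reachCount j u < reachCount (suc j) u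
    grow j u ns with FinP.any? (λ v → ¬? (BP._≟_ (R (suc j) u v) (R j u v)))
    ... | no none = ⊥-elim (ns (λ v → decidable-stable (BP._≟_ _ _) (λ ne → none (v , ne))))
    ... | yes (v , ne) = Σ-strict (allFin n) _ _ (λ x → 𝟙-mono (reach-suc j u x)) v (∈-allFin v)
                           (𝟙-strict (R j u v) (R (suc j) u v) (reach-suc j u v) ne)

    progress : ∀ u → Wv u → ∀ j → (∃[ i ] (i ℕ.≤ j × stable i u)) ⊎ (+ (suc j) ≤ reachCount j u)
    progress u wu zero = inj₂ (ℤP.≤-trans (ℤP.≤-reflexive (cong 𝟙 (sym (reach-refl wu))))
                                (Σ-elem-≤ (allFin n) (λ v → 𝟙 (R zero u v)) (λ v → 𝟙≥0 _) u (∈-allFin u)))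
    progress u wu (suc j) with progress u wu j
    ... | inj₁ (i , i≤j , st) = inj₁ (i , ℕP.m≤n⇒m≤1+n i≤j , st)
    ... | inj₂ big with stable? j u
    ...   | yes st = inj₁ (j , ℕP.n≤1+n j , st)
    ...   | no ns  = inj₂ (ℤP.≤-trans (ℤP.+-monoʳ-≤ 1ℤ big) (ℤP.i<j⇒suc[i]≤j (grow j u ns)))

    shorten : ∀ m u v → R m u v ≡ true → R n u v ≡ true
    shorten m u v e with progress u (proj₁ (reachW m u v e)) n
    ... | inj₂ big = ⊥-elim (ℤP.<-irrefl refl (ℤP.<-≤-trans (ℤ.+<+ ℕP.≤-refl) (ℤP.≤-trans big (reachCount≤n n u))))
    ... | inj₁ (i , i≤n , st) =
      reach-≤ u v i≤n (trans (sym (stable-+ i u st m v)) (reach-≤ u v (ℕP.m≤m+n m i) e))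

    Con : Fin n → Fin n → Set
    Con u v = connectedIn H W u v ≡ true

    conW : ∀ {u v} → Con u v → Wv u × Wv v
    conW {u} {v} = reachW n u v

    con-refl : ∀ {u} → Wv u → Con u u
    con-refl {u} wu = reach-≤ {m′ = n} u u ℕ.z≤n (reach-refl wu)

    con-step : ∀ {u w v} → Con u w → Wv v → adj H w v ≡ true → Con u v
    con-step {u} {w} {v} c wv a = shorten (suc n) u v (reach-step n u w v c wv a)

    con-ind : (J : Fin n → Set) → ∀ u → J u → (∀ w v → J w → Wv v → adj H w v ≡ true → J v) →
              ∀ v → Con u v → J v
    con-ind J u ju st v c = go n v c
      where
      go : ∀ m v → R m u v ≡ true → J v
      go zero v e = subst J (≟-true u v (proj₂ (∧-elim {lookup W u} e))) ju
      go (suc m) v e with ∨-elim e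
      ... | inj₁ e′ = go m v e′
      ... | inj₂ e′ = let (w , _ , q) = any-elim _ (allFin n) e′
                          (r , s) = ∧-elim q
                          (wv , a) = ∧-elim s
                      in st w v (go m w r) wv a

    con-edge : ∀ {u v} → Wv u → Wv v → adj H u v ≡ true → Con u v
    con-edge wu wv a = con-step (con-refl wu) wv a

    con-trans : ∀ {u w v} → Con u w → Con w v → Con u v
    con-trans {u} {w} {v} c₁ c₂ = con-ind (Con u) w c₁ (λ x y cx wy a → con-step cx wy a) v c₂

    con-sym : ∀ {u v} → Con u v → Con v u
    con-sym {u} {v} c = con-ind (λ x → Con x u) u (con-refl (proj₁ (conW c)))
      (λ w x cw wx a → con-trans (con-edge wx (proj₁ (conW cw)) (trans (Graph.sym H x w) a)) cw) v c

    isLeader : Fin n → Bool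
    isLeader v = lookup W v ∧ all (λ u → not (⌊ toℕ u <? toℕ v ⌋ ∧ connectedIn H W u v)) (allFin n)

    nc-leaders : + nc H W ≡ Σ (allFin n) (λ v → 𝟙 (isLeader v))
    nc-leaders = length-filter isLeader (allFin n)

    isLeader-elim : ∀ {v} → isLeader v ≡ true → Wv v × (∀ u → toℕ u ℕ.< toℕ v → ¬ Con u v)
    isLeader-elim {v} e = proj₁ (∧-elim e) , no-smaller
      where
      no-smaller : ∀ u → toℕ u ℕ.< toℕ v → ¬ Con u v
      no-smaller u lt c with not-true (all-elim _ (allFin n) (proj₂ (∧-elim {lookup W v} e)) u (∈-allFin u))
      ... | q with toℕ u <? toℕ v
      ... | yes _ rewrite c with () ← q
      ... | no ¬lt = ¬lt lt

    isLeader-intro : ∀ {v} → Wv v → (∀ u → toℕ u ℕ.< toℕ v → ¬ Con u v) → isLeader v ≡ true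
    isLeader-intro {v} wv h = ∧-intro wv (all-intro _ (allFin n) (λ u _ → not-smaller u))
      where
      not-smaller : ∀ u → not (⌊ toℕ u <? toℕ v ⌋ ∧ connectedIn H W u v) ≡ true
      not-smaller u with toℕ u <? toℕ v
      ... | no _ = refl
      ... | yes lt with connectedIn H W u v in c
      ...   | false = refl
      ...   | true  = ⊥-elim (h u lt c)

    leader-exists : ∀ v → Wv v → ∃[ ℓ ] (isLeader ℓ ≡ true × Con ℓ v)
    leader-exists v wv = go (suc (toℕ v)) v ℕP.≤-refl wv
      where
      go : ∀ k v → toℕ v ℕ.< k → Wv v → ∃[ ℓ ] (isLeader ℓ ≡ true × Con ℓ v)
      go (suc k) v lt wv with FinP.any? (λ u → (toℕ u <? toℕ v) ×-dec (connectedIn H W u v BP.≟ true))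
      ... | no none = v , isLeader-intro wv (λ u ul c → none (u , ul , c)) , con-refl wv
      ... | yes (u , ul , c) = let (ℓ , il , cl) = go k u (ℕP.<-≤-trans ul (ℕ.s≤s⁻¹ lt)) (proj₁ (conW c))
                               in ℓ , il , con-trans cl c

    leader-unique : ∀ {a b} → isLeader a ≡ true → isLeader b ≡ true → Con a b → a ≡ b
    leader-unique {a} {b} la lb c with ℕP.<-cmp (toℕ a) (toℕ b)
    ... | tri< lt _ _ = ⊥-elim (proj₂ (isLeader-elim lb) a lt c)
    ... | tri≈ _ eq _ = FinP.toℕ-injective eq
    ... | tri> _ _ gt = ⊥-elim (proj₂ (isLeader-elim la) b gt (con-sym c))

    nc-transversal : (T : Fin n → Bool) → (∀ t → T t ≡ true → Wv t) →
      (∀ v → Wv v → ∃[ t ] (T t ≡ true × Con t v × (∀ t′ → T t′ ≡ true → Con t′ v → t′ ≡ t))) →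
      + nc H W ≡ Σ (allFin n) (λ v → 𝟙 (T v))
    nc-transversal T TW tr = trans nc-leaders
      (Σ-matching (allFin n) (allFin n) (allFin⁺ n) (allFin⁺ n) isLeader T Rel (λ _ → 1ℤ) (λ _ → 1ℤ) hx hy hR)
      where
      Rel : Fin n → Fin n → Bool
      Rel a b = isLeader a ∧ T b ∧ connectedIn H W a b
      hx : ∀ a → a ∈ allFin n → isLeader a ≡ true →
           ∃[ b ] (b ∈ allFin n × Rel a b ≡ true × (∀ b′ → b′ ∈ allFin n → Rel a b′ ≡ true → b′ ≡ b))
      hx a _ la = let (t , Tt , ct , u) = tr a (proj₁ (isLeader-elim la)) in
        t , ∈-allFin t , ∧-intro la (∧-intro Tt (con-sym ct)) ,
        λ b′ _ r → let (_ , s) = ∧-elim {isLeader a} r ; (Tb , cb) = ∧-elim {T b′} s in u b′ Tb (con-sym cb)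
      hy : ∀ b → b ∈ allFin n → T b ≡ true →
           ∃[ a ] (a ∈ allFin n × Rel a b ≡ true × (∀ a′ → a′ ∈ allFin n → Rel a′ b ≡ true → a′ ≡ a))
      hy b _ Tb = let (ℓ , lℓ , cℓ) = leader-exists b (TW b Tb) in
        ℓ , ∈-allFin ℓ , ∧-intro lℓ (∧-intro Tb cℓ) ,
        λ a′ _ r → let (la′ , s) = ∧-elim {isLeader a′} r ; (_ , ca) = ∧-elim {T b} s in
          leader-unique la′ lℓ (con-trans ca (con-sym cℓ))
      hR : ∀ a b → Rel a b ≡ true → isLeader a ≡ true × T b ≡ true × 1ℤ ≡ 1ℤ
      hR a b r = let (la , s) = ∧-elim {isLeader a} r ; (Tb , _) = ∧-elim {T b} s in la , Tb , refl

-- Connected sums.  Setup restates IsConnectedSum in a symmetric form with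
-- Boolean membership, adding the facts ι₁(F₁) ⊆ ι₂(F₂) and ι₁ x = ι₂ y ⇒ y ∈ F₂,
-- which follow from |F₁| = |F₂| by counting.
module ConnectedSum where

  open Sums
  open Booleans
  open Subsets using (card-Σ; preimage)
  open Components
  open import Defs hiding (sym)
  open import Data.Bool using (Bool; true; false; _∧_)
  import Data.Bool.Properties as BP
  open import Data.Nat as ℕ using (ℕ)
  open import Data.Integer as ℤ using (ℤ; +_; 0ℤ; 1ℤ; _≤_)
  import Data.Integer.Properties as ℤP
  open import Data.Fin as Fin using (Fin)
  import Data.Fin.Properties as FinP
  open import Data.Fin.Subset using (Subset)
  open import Data.Vec using (lookup)
  import Data.Vec.Properties as VecP
  open import Data.List using (allFin)
  open import Data.List.Membership.Propositional.Properties using (∈-allFin)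
  open import Data.List.Relation.Unary.Unique.Propositional.Properties using (allFin⁺)
  open import Data.Product using (_×_; _,_; proj₁; proj₂; ∃-syntax)
  open import Data.Sum using (_⊎_; inj₁; inj₂)
  import Data.Sum
  open import Relation.Nullary using (yes; no)
  open import Relation.Nullary.Decidable using (⌊_⌋)
  open import Relation.Binary.PropositionalEquality
  open import Data.Empty using (⊥-elim)

  record Setup {n₁ n₂ m : ℕ} (G₁ : Graph n₁) (G₂ : Graph n₂) (G : Graph m)
      (F₁ : Subset n₁) (F₂ : Subset n₂) (ι₁ : Fin n₁ → Fin m) (ι₂ : Fin n₂ → Fin m) : Set where
    field
      complete₁ : ∀ x y → lookup F₁ x ≡ true → lookup F₁ y ≡ true → x ≢ y → adj G₁ x y ≡ true
      complete₂ : ∀ x y → lookup F₂ x ≡ true → lookup F₂ y ≡ true → x ≢ y → adj G₂ x y ≡ true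
      ι₁-inj    : ∀ {x y} → ι₁ x ≡ ι₁ y → x ≡ y
      ι₂-inj    : ∀ {x y} → ι₂ x ≡ ι₂ y → x ≡ y
      cover     : ∀ v → (∃[ x ] ι₁ x ≡ v) ⊎ (∃[ y ] ι₂ y ≡ v)
      meet₁     : ∀ x y → ι₁ x ≡ ι₂ y → lookup F₁ x ≡ true
      meet₂     : ∀ x y → ι₁ x ≡ ι₂ y → lookup F₂ y ≡ true
      glue₁     : ∀ x → lookup F₁ x ≡ true → ∃[ y ] ι₁ x ≡ ι₂ y
      glue₂     : ∀ y → lookup F₂ y ≡ true → ∃[ x ] ι₂ y ≡ ι₁ x
      edge⇒     : ∀ u v → adj G u v ≡ true →
                    (∃[ x ] ∃[ y ] (ι₁ x ≡ u × ι₁ y ≡ v × adj G₁ x y ≡ true))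
                  ⊎ (∃[ x ] ∃[ y ] (ι₂ x ≡ u × ι₂ y ≡ v × adj G₂ x y ≡ true))
      edge₁     : ∀ x y → adj G₁ x y ≡ true → adj G (ι₁ x) (ι₁ y) ≡ true
      edge₂     : ∀ x y → adj G₂ x y ≡ true → adj G (ι₂ x) (ι₂ y) ≡ true

  swapS : ∀ {n₁ n₂ m} {G₁ : Graph n₁} {G₂ : Graph n₂} {G : Graph m} {F₁ F₂ ι₁ ι₂} →
          Setup G₁ G₂ G F₁ F₂ ι₁ ι₂ → Setup G₂ G₁ G F₂ F₁ ι₂ ι₁
  swapS S = record
    { complete₁ = complete₂ ; complete₂ = complete₁ ; ι₁-inj = ι₂-inj ; ι₂-inj = ι₁-inj
    ; cover = λ v → Data.Sum.swap (cover v)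
    ; meet₁ = λ x y e → meet₂ y x (sym e) ; meet₂ = λ x y e → meet₁ y x (sym e)
    ; glue₁ = glue₂ ; glue₂ = glue₁
    ; edge⇒ = λ u v a → Data.Sum.swap (edge⇒ u v a)
    ; edge₁ = edge₂ ; edge₂ = edge₁ }
    where open Setup S

  module FromIsConnectedSum {n₁ n₂ m : ℕ} {t : ℕ} {G₁ : Graph n₁} {G₂ : Graph n₂} {G : Graph m}
      {F₁ : Subset n₁} {F₂ : Subset n₂} {ι₁ : Fin n₁ → Fin m} {ι₂ : Fin n₂ → Fin m}
      (CS : IsConnectedSum t G₁ G₂ G F₁ F₂ ι₁ ι₂) where
    open IsConnectedSum CS

    toL : ∀ {k} {F : Subset k} {x} → Data.Fin.Subset._∈_ x F → lookup F x ≡ true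
    toL = VecP.[]=⇒lookup
    fromL : ∀ {k} {F : Subset k} {x} → lookup F x ≡ true → Data.Fin.Subset._∈_ x F
    fromL {F = F} {x} = VecP.lookup⇒[]= x F

    gluedTo : Fin n₁ → Fin n₂ → Bool
    gluedTo x y = lookup F₂ y ∧ ⌊ ι₂ y Fin.≟ ι₁ x ⌋

    gluedCount : Fin n₁ → ℤ
    gluedCount x = Σ (allFin n₂) (λ y → 𝟙 (gluedTo x y))

    no-glued : ∀ x → (∀ y → gluedTo x y ≢ true) → gluedCount x ≡ 0ℤ
    no-glued x none = Σ-zero (allFin n₂) (λ y _ → zero-term y)
      where
      zero-term : ∀ y → 𝟙 (gluedTo x y) ≡ 0ℤ
      zero-term y with gluedTo x y in e
      ... | false = refl
      ... | true  = ⊥-elim (none y e)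

    -- every point of F₂ is glued onto exactly one point (of F₁), so Σ gluedCount = |F₂|
    Σ-gluedCount : Σ (allFin n₁) gluedCount ≡ Σ (allFin n₂) (λ y → 𝟙 (lookup F₂ y))
    Σ-gluedCount = trans (Σ-swap (allFin n₁) (allFin n₂) (λ x y → 𝟙 (gluedTo x y))) (Σ-cong (allFin n₂) per-point)
      where
      per-point : ∀ y → Σ (allFin n₁) (λ x → 𝟙 (gluedTo x y)) ≡ 𝟙 (lookup F₂ y)
      per-point y with lookup F₂ y in f
      ... | false = Σ-0 (allFin n₁)
      ... | true = let (x₀ , _ , e₀) = glue y (fromL f) in
        trans (Σ-cong (allFin n₁) (λ x → cong 𝟙 (cong (λ b → b ∧ ⌊ ι₂ y Fin.≟ ι₁ x ⌋) (sym f))))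
              (Σ-unique (allFin n₁) (allFin⁺ n₁) (λ x → gluedTo x y) (λ _ → 1ℤ) x₀ (∈-allFin x₀)
                 (∧-intro f (subst (λ z → ⌊ z Fin.≟ ι₁ x₀ ⌋ ≡ true) (sym e₀) (≟-refl _)))
                 (λ x _ r → ι₁-inj (trans (sym (≟-true _ _ (proj₂ (∧-elim {lookup F₂ y} r)))) e₀)))

    -- only points of F₁ receive glued points, at most one each
    gluedCount≤ : ∀ x → gluedCount x ≤ 𝟙 (lookup F₁ x)
    gluedCount≤ x with FinP.any? (λ y → gluedTo x y BP.≟ true)
    ... | no none = ℤP.≤-trans (ℤP.≤-reflexive (no-glued x (λ y e → none (y , e)))) (𝟙≥0 _)
    ... | yes (y₀ , p) = ℤP.≤-reflexive (trans
          (Σ-unique (allFin n₂) (allFin⁺ n₂) (gluedTo x) (λ _ → 1ℤ) y₀ (∈-allFin y₀) p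
             (λ y _ r → ι₂-inj (trans (≟-true _ _ (proj₂ (∧-elim {lookup F₂ y} r)))
                                      (sym (≟-true _ _ (proj₂ (∧-elim {lookup F₂ y₀} p)))))))
          (cong 𝟙 (sym x∈F₁)))
      where
      x∈F₁ : lookup F₁ x ≡ true
      x∈F₁ = let (x′ , x′∈ , e′) = glue y₀ (fromL (proj₁ (∧-elim {lookup F₂ y₀} p)))
                 e₀ = ≟-true _ _ (proj₂ (∧-elim {lookup F₂ y₀} p))
             in subst (λ z → lookup F₁ z ≡ true) (ι₁-inj (trans (sym e′) e₀)) (toL x′∈)

    -- since |F₁| = |F₂|, the inequality is an equality everywhere
    gluedCount≡ : ∀ x → gluedCount x ≡ 𝟙 (lookup F₁ x)
    gluedCount≡ x = Σ-≤-equal (allFin n₁) gluedCount≤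
      (trans Σ-gluedCount (trans (sym (card-Σ F₂)) (trans (cong +_ (trans card₂ (sym card₁))) (card-Σ F₁))))
      x (∈-allFin x)

    F₁-glued : ∀ x → lookup F₁ x ≡ true → ∃[ y ] (lookup F₂ y ≡ true × ι₂ y ≡ ι₁ x)
    F₁-glued x f with FinP.any? (λ y → gluedTo x y BP.≟ true)
    ... | yes (y , p) = let (a , b) = ∧-elim {lookup F₂ y} p in y , a , ≟-true _ _ b
    ... | no none with () ← trans (sym (no-glued x (λ y e → none (y , e)))) (trans (gluedCount≡ x) (cong 𝟙 f))

    toSetup : Setup G₁ G₂ G F₁ F₂ ι₁ ι₂
    toSetup = record
      { complete₁ = λ x y fx fy ne → complete₁ x y (fromL fx) (fromL fy) ne
      ; complete₂ = λ x y fx fy ne → complete₂ x y (fromL fx) (fromL fy) ne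
      ; ι₁-inj = ι₁-inj ; ι₂-inj = ι₂-inj ; cover = cover
      ; meet₁ = λ x y e → toL (meet x y e)
      ; meet₂ = λ x y e → let (y′ , f , e′) = F₁-glued x (toL (meet x y e)) in
                          subst (λ z → lookup F₂ z ≡ true) (ι₂-inj (trans e′ e)) f
      ; glue₁ = λ x f → let (y , _ , e) = F₁-glued x f in y , sym e
      ; glue₂ = λ y f → let (x , _ , e) = glue y (fromL f) in x , e
      ; edge⇒ = edge⇒ ; edge₁ = edge₁ ; edge₂ = edge₂ }

  -- Transfer of connectivity between G|_W and the side G₁|_W₁, W₁ = ι₁⁻¹(W).
  -- Applied to swapS S it gives the same facts for the side G₂.
  module Transfer {n₁ n₂ m : ℕ} {G₁ : Graph n₁} {G₂ : Graph n₂} {G : Graph m}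
      {F₁ : Subset n₁} {F₂ : Subset n₂} {ι₁ : Fin n₁ → Fin m} {ι₂ : Fin n₂ → Fin m}
      (S : Setup G₁ G₂ G F₁ F₂ ι₁ ι₂) (W : Subset m) where
    open Setup S

    W₁ : Subset n₁
    W₁ = preimage ι₁ W
    W₂ : Subset n₂
    W₂ = preimage ι₂ W

    W₁≡ : ∀ x → lookup W₁ x ≡ lookup W (ι₁ x)
    W₁≡ x = VecP.lookup∘tabulate _ x
    W₂≡ : ∀ y → lookup W₂ y ≡ lookup W (ι₂ y)
    W₂≡ y = VecP.lookup∘tabulate _ y

    module C  = Induced G W
    module C₁ = Induced G₁ W₁
    module C₂ = Induced G₂ W₂

    lift : ∀ {x y} → C₁.Con x y → C.Con (ι₁ x) (ι₁ y)
    lift {x} {y} c = C₁.con-ind (λ z → C.Con (ι₁ x) (ι₁ z)) x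
      (C.con-refl (trans (sym (W₁≡ x)) (proj₁ (C₁.conW c))))
      (λ w z cw wz a → C.con-step cw (trans (sym (W₁≡ z)) wz) (edge₁ w z a)) y c

    -- What is known about a vertex v connected to ι₁ x in G|_W: its ι₁-preimage
    -- is connected to x in G₁|_W₁, and its ι₂-preimage is reached from a clique
    -- point a connected to x, through G₂|_W₂ starting at the twin a′ of a.
    Reached : Fin n₁ → Fin m → Set
    Reached x v = (∀ z → ι₁ z ≡ v → C₁.Con x z) ×
                  (∀ z → ι₂ z ≡ v → ∃[ a ] (lookup F₁ a ≡ true × C₁.Con x a × ∃[ a′ ] (ι₂ a′ ≡ ι₁ a × C₂.Con a′ z)))

    reached : ∀ {x v} → C.Con (ι₁ x) v → Reached x v
    reached {x} {v} c = C.con-ind (Reached x) (ι₁ x) base step v c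
      where
      wx : lookup W (ι₁ x) ≡ true
      wx = proj₁ (C.conW c)
      base : Reached x (ι₁ x)
      base = (λ z e → subst (C₁.Con x) (ι₁-inj (sym e)) (C₁.con-refl (trans (W₁≡ x) wx))) ,
             (λ z e → x , meet₁ x z (sym e) , C₁.con-refl (trans (W₁≡ x) wx) , z , e ,
                      C₂.con-refl (trans (W₂≡ z) (trans (cong (lookup W) e) wx)))
      -- an edge of G is an edge of one side; on the second side, a step back
      -- into the clique is taken care of by completeness of F₁
      step : ∀ w v → Reached x w → lookup W v ≡ true → adj G w v ≡ true → Reached x v
      step w v (on₁ , on₂) wv a with edge⇒ w v a
      ... | inj₁ (p , q , refl , refl , a₁) =
            (λ z e → subst (C₁.Con x) (ι₁-inj (sym e)) cq) ,
            (λ z e → q , meet₁ q z (sym e) , cq , z , e , C₂.con-refl (trans (W₂≡ z) (trans (cong (lookup W) e) wv)))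
        where
        cq : C₁.Con x q
        cq = C₁.con-step (on₁ p refl) (trans (W₁≡ q) wv) a₁
      ... | inj₂ (p , q , refl , refl , a₂) with on₂ p refl
      ...   | (a₀ , Fa₀ , ca₀ , a₀′ , e₀ , cp) = first , second
        where
        cq : C₂.Con a₀′ q
        cq = C₂.con-step cp (trans (W₂≡ q) wv) a₂
        first : ∀ z → ι₁ z ≡ ι₂ q → C₁.Con x z
        first z e with a₀ Fin.≟ z
        ... | yes refl = ca₀
        ... | no ne = C₁.con-step ca₀ (trans (W₁≡ z) (trans (cong (lookup W) e) wv))
                        (complete₁ a₀ z Fa₀ (meet₁ z q e) ne)
        second : ∀ z → ι₂ z ≡ ι₂ q → ∃[ a ] (lookup F₁ a ≡ true × C₁.Con x a × ∃[ a′ ] (ι₂ a′ ≡ ι₁ a × C₂.Con a′ z))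
        second z e = a₀ , Fa₀ , ca₀ , a₀′ , e₀ , subst (C₂.Con a₀′) (ι₂-inj (sym e)) cq

    reflect : ∀ {x y} → C.Con (ι₁ x) (ι₁ y) → C₁.Con x y
    reflect c = proj₁ (reached c) _ refl

    cross : ∀ {x y} → C.Con (ι₁ x) (ι₂ y) →
            ∃[ a ] (lookup F₁ a ≡ true × C₁.Con x a × ∃[ a′ ] (ι₂ a′ ≡ ι₁ a × C₂.Con a′ y))
    cross c = proj₂ (reached c) _ refl

-- A transversal of the components of G|_W is formed by the images of the
-- leaders of G₁|_W₁ together with the images of those leaders of G₂|_W₂ whose
-- component does not meet F₂ (there is exactly one that does, if W₂ meets F₂).
module ComponentCount where

  open Sums
  open Booleans
  open Subsets using (avoids; avoids-sound; avoids-false)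
  open Components
  open ConnectedSum
  open import Defs hiding (sym)
  open import Data.Bool using (Bool; true; false; not; _∧_; _∨_)
  open import Data.Bool.ListAction using (any)
  open import Data.Nat as ℕ using (ℕ)
  open import Data.Integer as ℤ using (ℤ; +_; 0ℤ; 1ℤ; _+_; _-_)
  import Data.Integer.Properties as ℤP
  open import Data.Fin as Fin using (Fin)
  open import Data.Fin.Subset using (Subset)
  open import Data.Vec using (lookup)
  open import Data.List using (allFin)
  open import Data.List.Membership.Propositional using (_∈_)
  open import Data.List.Membership.Propositional.Properties using (∈-allFin)
  open import Data.List.Relation.Unary.Unique.Propositional.Properties using (allFin⁺)
  open import Data.Product using (_×_; _,_; proj₁; proj₂; ∃-syntax)
  open import Data.Sum using (_⊎_; inj₁; inj₂)
  open import Relation.Nullary using (yes; no)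
  open import Relation.Nullary.Decidable using (⌊_⌋)
  open import Relation.Binary.PropositionalEquality
  open import Data.Empty using (⊥; ⊥-elim)
  import Data.Bool.Properties as BP
  open import Data.Integer.Tactic.RingSolver

  d : ∀ {n} → Graph n → Subset n → ℤ
  d H W = + nc H W - + 1

  image-count : ∀ {a m} (ι : Fin a → Fin m) → (∀ {x y} → ι x ≡ ι y → x ≡ y) → (P : Fin a → Bool) →
    Σ (allFin m) (λ v → 𝟙 (any (λ x → ⌊ ι x Fin.≟ v ⌋ ∧ P x) (allFin a))) ≡ Σ (allFin a) (λ x → 𝟙 (P x))
  image-count {a} {m} ι inj P =
    sym (Σ-matching (allFin a) (allFin m) (allFin⁺ a) (allFin⁺ m) P Q Rel (λ _ → 1ℤ) (λ _ → 1ℤ) hx hy hR)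
    where
    Q : Fin m → Bool
    Q v = any (λ x → ⌊ ι x Fin.≟ v ⌋ ∧ P x) (allFin a)
    Rel : Fin a → Fin m → Bool
    Rel x v = ⌊ ι x Fin.≟ v ⌋ ∧ P x
    hx : ∀ x → x ∈ allFin a → P x ≡ true →
         ∃[ v ] (v ∈ allFin m × Rel x v ≡ true × (∀ v′ → v′ ∈ allFin m → Rel x v′ ≡ true → v′ ≡ v))
    hx x _ px = ι x , ∈-allFin _ , ∧-intro (≟-refl (ι x)) px ,
                λ v′ _ r → sym (≟-true _ _ (proj₁ (∧-elim r)))
    hy : ∀ v → v ∈ allFin m → Q v ≡ true →
         ∃[ x ] (x ∈ allFin a × Rel x v ≡ true × (∀ x′ → x′ ∈ allFin a → Rel x′ v ≡ true → x′ ≡ x))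
    hy v _ q = let (x , _ , r) = any-elim _ (allFin a) q in
      x , ∈-allFin x , r ,
      λ x′ _ r′ → inj (trans (≟-true _ _ (proj₁ (∧-elim r′))) (sym (≟-true _ _ (proj₁ (∧-elim r)))))
    hR : ∀ x v → Rel x v ≡ true → P x ≡ true × Q v ≡ true × 1ℤ ≡ 1ℤ
    hR x v r = proj₂ (∧-elim r) , any-intro _ (allFin a) x (∈-allFin x) r , refl

  module Count {n₁ n₂ m : ℕ} {G₁ : Graph n₁} {G₂ : Graph n₂} {G : Graph m}
      {F₁ : Subset n₁} {F₂ : Subset n₂} {ι₁ : Fin n₁ → Fin m} {ι₂ : Fin n₂ → Fin m}
      (S : Setup G₁ G₂ G F₁ F₂ ι₁ ι₂) (W : Subset m) where
    open Setup S
    module A = Transfer S W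
    module B = Transfer (swapS S) W
    open A using (W₁; W₂; W₁≡; W₂≡)
    module C  = Induced G W
    module C₁ = Induced G₁ W₁
    module C₂ = Induced G₂ W₂

    touchesF₂ : Fin n₂ → Bool
    touchesF₂ y = any (λ a → lookup F₂ a ∧ connectedIn G₂ W₂ a y) (allFin n₂)

    touchesF₂-intro : ∀ a y → lookup F₂ a ≡ true → C₂.Con a y → touchesF₂ y ≡ true
    touchesF₂-intro a y fa c = any-intro _ (allFin n₂) a (∈-allFin a) (∧-intro fa c)

    T₁ T₂ Tr : Fin m → Bool
    T₁ v = any (λ x → ⌊ ι₁ x Fin.≟ v ⌋ ∧ C₁.isLeader x) (allFin n₁)
    T₂ v = any (λ y → ⌊ ι₂ y Fin.≟ v ⌋ ∧ (C₂.isLeader y ∧ not (touchesF₂ y))) (allFin n₂)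
    Tr v = T₁ v ∨ T₂ v

    Tr-view : ∀ v → Tr v ≡ true →
      (∃[ x ] (ι₁ x ≡ v × C₁.isLeader x ≡ true)) ⊎ (∃[ y ] (ι₂ y ≡ v × C₂.isLeader y ≡ true × touchesF₂ y ≡ false))
    Tr-view v e with ∨-elim {T₁ v} e
    ... | inj₁ e₁ = let (x , _ , r) = any-elim _ (allFin n₁) e₁ ; (p , q) = ∧-elim r in
                    inj₁ (x , ≟-true _ _ p , q)
    ... | inj₂ e₂ = let (y , _ , r) = any-elim _ (allFin n₂) e₂ ; (p , q) = ∧-elim r
                        (l , nm) = ∧-elim {C₂.isLeader y} q in
                    inj₂ (y , ≟-true _ _ p , l , not-true nm)

    T₁-intro : ∀ x → C₁.isLeader x ≡ true → Tr (ι₁ x) ≡ true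
    T₁-intro x l
      rewrite any-intro (λ x′ → ⌊ ι₁ x′ Fin.≟ ι₁ x ⌋ ∧ C₁.isLeader x′) (allFin n₁) x (∈-allFin x)
                        (∧-intro (≟-refl (ι₁ x)) l) = refl

    T₂-intro : ∀ y → C₂.isLeader y ≡ true → touchesF₂ y ≡ false → Tr (ι₂ y) ≡ true
    T₂-intro y l nm with T₁ (ι₂ y)
    ... | true  = refl
    ... | false = any-intro _ (allFin n₂) y (∈-allFin y) (∧-intro (≟-refl (ι₂ y)) (∧-intro l (not-intro nm)))

    Tr⊆W : ∀ t → Tr t ≡ true → lookup W t ≡ true
    Tr⊆W t e with Tr-view t e
    ... | inj₁ (x , refl , lx) = trans (sym (W₁≡ x)) (proj₁ (C₁.isLeader-elim lx))
    ... | inj₂ (y , refl , ly , _) = trans (sym (W₂≡ y)) (proj₁ (C₂.isLeader-elim ly))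

    cross-touches : ∀ x y → C.Con (ι₁ x) (ι₂ y) → touchesF₂ y ≡ true
    cross-touches x y c = let (a , Fa , _ , a′ , e , c₂) = A.cross c in
                          touchesF₂-intro a′ y (meet₂ a a′ (sym e)) c₂

    Tr-separated : ∀ a b → Tr a ≡ true → Tr b ≡ true → C.Con a b → a ≡ b
    Tr-separated a b ta tb c with Tr-view a ta | Tr-view b tb
    ... | inj₁ (x , refl , lx) | inj₁ (x′ , refl , lx′) = cong ι₁ (C₁.leader-unique lx lx′ (A.reflect c))
    ... | inj₁ (x , refl , lx) | inj₂ (y , refl , ly , my) with () ← trans (sym (cross-touches x y c)) my
    ... | inj₂ (y , refl , ly , my) | inj₁ (x , refl , lx) with () ← trans (sym (cross-touches x y (C.con-sym c))) my
    ... | inj₂ (y , refl , ly , my) | inj₂ (y′ , refl , ly′ , my′) = cong ι₂ (C₂.leader-unique ly ly′ (B.reflect c))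

    Tr-covers : ∀ v → lookup W v ≡ true → ∃[ t ] (Tr t ≡ true × C.Con t v)
    Tr-covers v wv with cover v
    ... | inj₁ (x , refl) = let (ℓ , lℓ , cℓ) = C₁.leader-exists x (trans (W₁≡ x) wv) in
                            ι₁ ℓ , T₁-intro ℓ lℓ , A.lift cℓ
    ... | inj₂ (y , refl) with touchesF₂ y in my
    ...   | true = let (a , _ , r) = any-elim _ (allFin n₂) my
                       (Fa , ca) = ∧-elim r
                       (x₀ , e₀) = glue₂ a Fa
                       w₁x₀ = trans (W₁≡ x₀) (trans (cong (lookup W) (sym e₀)) (trans (sym (W₂≡ a)) (proj₁ (C₂.conW ca))))
                       (ℓ , lℓ , cℓ) = C₁.leader-exists x₀ w₁x₀
                   in ι₁ ℓ , T₁-intro ℓ lℓ , C.con-trans (A.lift cℓ) (subst (λ z → C.Con z (ι₂ y)) e₀ (B.lift ca))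
    ...   | false = let (ℓ , lℓ , cℓ) = C₂.leader-exists y (trans (W₂≡ y) wv) in
                    ι₂ ℓ , T₂-intro ℓ lℓ (leader-avoids ℓ cℓ) , B.lift cℓ
      where
      leader-avoids : ∀ ℓ → C₂.Con ℓ y → touchesF₂ ℓ ≡ false
      leader-avoids ℓ cℓ with touchesF₂ ℓ in e
      ... | false = refl
      ... | true = let (a , _ , r) = any-elim _ (allFin n₂) e ; (Fa , ca) = ∧-elim r in
                   ⊥-elim (t≢f (trans (sym (touchesF₂-intro a y Fa (C₂.con-trans ca cℓ))) my))

    nc-Tr : + nc G W ≡ Σ (allFin m) (λ v → 𝟙 (Tr v))
    nc-Tr = C.nc-transversal Tr Tr⊆W
      (λ v wv → let (t , tt , ct) = Tr-covers v wv in
         t , tt , ct , λ t′ tt′ ct′ → Tr-separated t′ t tt′ tt (C.con-trans ct′ (C.con-sym ct)))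

    T₁-T₂-disjoint : ∀ v → T₁ v ≡ true → T₂ v ≡ true → ⊥
    T₁-T₂-disjoint v e₁ e₂ =
      let (x , _ , r) = any-elim _ (allFin n₁) e₁ ; (p , _) = ∧-elim r
          (y , _ , r′) = any-elim _ (allFin n₂) e₂ ; (p′ , q′) = ∧-elim r′
          (l , nm) = ∧-elim {C₂.isLeader y} q′
          Fy = meet₂ x y (trans (≟-true _ _ p) (sym (≟-true _ _ p′)))
      in t≢f (trans (sym (touchesF₂-intro y y Fy (C₂.con-refl (proj₁ (C₂.isLeader-elim l))))) (not-true nm))

    -- F₂ is a clique, so the leaders whose component meets F₂ number [W₂ meets F₂]
    touching-leaders : Σ (allFin n₂) (λ y → 𝟙 (C₂.isLeader y ∧ touchesF₂ y)) ≡ 𝟙 (not (avoids F₂ W₂))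
    touching-leaders with avoids F₂ W₂ in e
    ... | true = Σ-zero (allFin n₂) (λ y _ → none y)
      where
      none : ∀ y → 𝟙 (C₂.isLeader y ∧ touchesF₂ y) ≡ 0ℤ
      none y with touchesF₂ y in my
      ... | false = cong 𝟙 (BP.∧-zeroʳ (C₂.isLeader y))
      ... | true = let (a , _ , r) = any-elim _ (allFin n₂) my ; (Fa , ca) = ∧-elim r in
                   ⊥-elim (t≢f (trans (sym (proj₁ (C₂.conW ca))) (avoids-sound F₂ W₂ e a Fa)))
    ... | false = let (a₀ , Fa₀ , wa₀) = avoids-false F₂ W₂ e
                      (ℓ , lℓ , cℓ) = C₂.leader-exists a₀ wa₀
                  in Σ-unique (allFin n₂) (allFin⁺ n₂) (λ y → C₂.isLeader y ∧ touchesF₂ y) (λ _ → 1ℤ) ℓ (∈-allFin ℓ)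
                       (∧-intro lℓ (touchesF₂-intro a₀ ℓ Fa₀ (C₂.con-sym cℓ)))
                       (λ y _ py → unique a₀ Fa₀ wa₀ ℓ lℓ cℓ y py)
      where
      unique : ∀ a₀ → lookup F₂ a₀ ≡ true → lookup W₂ a₀ ≡ true → ∀ ℓ → C₂.isLeader ℓ ≡ true → C₂.Con ℓ a₀ →
               ∀ y → (C₂.isLeader y ∧ touchesF₂ y) ≡ true → y ≡ ℓ
      unique a₀ Fa₀ wa₀ ℓ lℓ cℓ y py =
        let (ly , my) = ∧-elim {C₂.isLeader y} py
            (a , _ , r) = any-elim _ (allFin n₂) my
            (Fa , ca) = ∧-elim r
        in C₂.leader-unique ly lℓ (C₂.con-trans (C₂.con-sym ca)
             (C₂.con-trans (clique-connected a Fa (proj₁ (C₂.conW ca))) (C₂.con-sym cℓ)))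
        where
        clique-connected : ∀ a → lookup F₂ a ≡ true → lookup W₂ a ≡ true → C₂.Con a a₀
        clique-connected a Fa wa with a Fin.≟ a₀
        ... | yes refl = C₂.con-refl wa
        ... | no ne = C₂.con-edge wa wa₀ (complete₂ a a₀ Fa Fa₀ ne)

    nc-glue : + nc G W ≡ + nc G₁ W₁ + (+ nc G₂ W₂ - 𝟙 (not (avoids F₂ W₂)))
    nc-glue = begin
      + nc G W ≡⟨ nc-Tr ⟩
      Σ (allFin m) (λ v → 𝟙 (Tr v)) ≡⟨ Σ-cong (allFin m) (λ v → 𝟙-∨ (T₁ v) (T₂ v) (T₁-T₂-disjoint v)) ⟩
      Σ (allFin m) (λ v → 𝟙 (T₁ v) + 𝟙 (T₂ v)) ≡⟨ Σ-+ (allFin m) _ _ ⟩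
      Σ (allFin m) (λ v → 𝟙 (T₁ v)) + Σ (allFin m) (λ v → 𝟙 (T₂ v))
        ≡⟨ cong₂ _+_ (image-count ι₁ ι₁-inj C₁.isLeader)
                     (image-count ι₂ ι₂-inj (λ y → C₂.isLeader y ∧ not (touchesF₂ y))) ⟩
      Σ (allFin n₁) (λ x → 𝟙 (C₁.isLeader x)) + s
        ≡⟨ cong₂ _+_ (sym C₁.nc-leaders) second-side ⟩
      + nc G₁ W₁ + (+ nc G₂ W₂ - 𝟙 (not (avoids F₂ W₂))) ∎
      where
      open ≡-Reasoning
      s t : ℤ
      s = Σ (allFin n₂) (λ y → 𝟙 (C₂.isLeader y ∧ not (touchesF₂ y)))
      t = Σ (allFin n₂) (λ y → 𝟙 (C₂.isLeader y ∧ touchesF₂ y))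
      leaders-split : s + t ≡ + nc G₂ W₂
      leaders-split = trans (sym (Σ-+ (allFin n₂) _ _))
        (trans (sym (Σ-cong (allFin n₂) (λ y → 𝟙-split (C₂.isLeader y) (touchesF₂ y)))) (sym C₂.nc-leaders))
      second-side : s ≡ + nc G₂ W₂ - 𝟙 (not (avoids F₂ W₂))
      second-side = begin
        s            ≡⟨ sym (ℤP.+-identityʳ s) ⟩
        s + 0ℤ       ≡⟨ cong (_+_ s) (sym (ℤP.+-inverseʳ t)) ⟩
        s + (t - t)  ≡⟨ sym (ℤP.+-assoc s t (ℤ.- t)) ⟩
        (s + t) - t  ≡⟨ cong₂ _-_ leaders-split touching-leaders ⟩
        + nc G₂ W₂ - 𝟙 (not (avoids F₂ W₂)) ∎

    d-glue : d G W ≡ (d G₁ W₁ + d G₂ W₂) + 𝟙 (avoids F₂ W₂)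
    d-glue = trans (cong (_- + 1) nc-glue)
      (trans (rearrange (+ nc G₁ W₁) (+ nc G₂ W₂) (𝟙 (not (avoids F₂ W₂))))
             (cong (λ z → (d G₁ W₁ + d G₂ W₂) + z) (sym (𝟙-not (avoids F₂ W₂)))))
      where
      rearrange : ∀ a b c → (a + (b - c)) - + 1 ≡ ((a - + 1) + (b - + 1)) + (+ 1 - c)
      rearrange = solve-∀
      𝟙-not : ∀ z → 𝟙 z ≡ + 1 - 𝟙 (not z)
      𝟙-not true = refl
      𝟙-not false = refl

-- Subsets W of V(G) correspond bijectively to pairs (W₁, X) of a subset of V₁
-- and a subset of V₂ avoiding F₂, with W = ι₁(W₁) ∪ ι₂(X) and |W| = |W₁| + |X|.
module Reindex where

  open Sums
  open Booleans
  open Subsets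
  open ConnectedSum
  open import Defs hiding (sym)
  open import Data.Bool using (Bool; true; false; not; _∧_)
  import Data.Bool.Properties as BP
  open import Data.Nat as ℕ using (ℕ)
  open import Data.Integer as ℤ using (ℤ; +_; _+_)
  import Data.Integer.Properties as ℤP
  open import Data.Fin as Fin using (Fin)
  import Data.Fin.Properties as FinP
  open import Data.Fin.Subset using (Subset; ∣_∣)
  open import Data.Vec as Vec using (Vec; lookup; tabulate)
  import Data.Vec.Properties as VecP
  open import Data.List using (allFin; cartesianProduct)
  open import Data.List.Membership.Propositional using (_∈_)
  open import Data.List.Membership.Propositional.Properties using (∈-allFin; ∈-cartesianProduct⁺)
  open import Data.List.Relation.Unary.Unique.Propositional.Properties using (allFin⁺; cartesianProduct⁺)
  open import Data.Product using (_×_; _,_; proj₁; proj₂; ∃; ∃-syntax)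
  open import Data.Sum using (inj₁; inj₂)
  open import Relation.Nullary using (Dec; yes; no)
  open import Relation.Nullary.Decidable using (⌊_⌋)
  open import Relation.Binary.PropositionalEquality
  open import Data.Empty using (⊥-elim)

  vec-ext : ∀ {A : Set} {n} (xs ys : Vec A n) → (∀ i → lookup xs i ≡ lookup ys i) → xs ≡ ys
  vec-ext xs ys h = trans (sym (VecP.tabulate∘lookup xs)) (trans (VecP.tabulate-cong h) (VecP.tabulate∘lookup ys))

  module Reindex {n₁ n₂ m : ℕ} {G₁ : Graph n₁} {G₂ : Graph n₂} {G : Graph m}
      {F₁ : Subset n₁} {F₂ : Subset n₂} {ι₁ : Fin n₁ → Fin m} {ι₂ : Fin n₂ → Fin m}
      (S : Setup G₁ G₂ G F₁ F₂ ι₁ ι₂) where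
    open Setup S

    pre₁ : ∀ v → Dec (∃ λ x → ι₁ x ≡ v)
    pre₁ v = FinP.any? (λ x → ι₁ x Fin.≟ v)
    pre₂ : ∀ v → Dec (∃ λ y → ι₂ y ≡ v)
    pre₂ v = FinP.any? (λ y → ι₂ y Fin.≟ v)

    choose : ∀ {v} → Subset n₁ → Subset n₂ → Dec (∃ λ x → ι₁ x ≡ v) → Dec (∃ λ y → ι₂ y ≡ v) → Bool
    choose W₁ X (yes (x , _)) _            = lookup W₁ x
    choose W₁ X (no _)        (yes (y , _)) = lookup X y
    choose W₁ X (no _)        (no _)        = false

    join : Subset n₁ → Subset n₂ → Subset m
    join W₁ X = tabulate (λ v → choose W₁ X (pre₁ v) (pre₂ v))

    restrict₂ : Subset m → Subset n₂
    restrict₂ W = tabulate (λ y → lookup W (ι₂ y) ∧ not (lookup F₂ y))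

    join-ι₁ : ∀ W₁ X x → lookup (join W₁ X) (ι₁ x) ≡ lookup W₁ x
    join-ι₁ W₁ X x = trans (VecP.lookup∘tabulate _ (ι₁ x)) (choose₁ (pre₁ (ι₁ x)) (pre₂ (ι₁ x)))
      where
      choose₁ : (d₁ : Dec (∃ λ x′ → ι₁ x′ ≡ ι₁ x)) → ∀ d₂ → choose W₁ X d₁ d₂ ≡ lookup W₁ x
      choose₁ (yes (x′ , e)) d₂ = cong (lookup W₁) (ι₁-inj e)
      choose₁ (no ¬e) d₂ = ⊥-elim (¬e (x , refl))

    join-ι₂ : ∀ W₁ X y → lookup F₂ y ≡ false → lookup (join W₁ X) (ι₂ y) ≡ lookup X y
    join-ι₂ W₁ X y f = trans (VecP.lookup∘tabulate _ (ι₂ y)) (choose₂ (pre₁ (ι₂ y)) (pre₂ (ι₂ y)))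
      where
      choose₂ : (d₁ : Dec (∃ λ x → ι₁ x ≡ ι₂ y)) (d₂ : Dec (∃ λ y′ → ι₂ y′ ≡ ι₂ y)) →
                choose W₁ X d₁ d₂ ≡ lookup X y
      choose₂ (yes (x , e)) d₂ = ⊥-elim (t≢f (trans (sym (meet₂ x y e)) f))
      choose₂ (no _) (yes (y′ , e)) = cong (lookup X) (ι₂-inj e)
      choose₂ (no _) (no ¬e) = ⊥-elim (¬e (y , refl))

    preimage-join : ∀ W₁ X → preimage ι₁ (join W₁ X) ≡ W₁
    preimage-join W₁ X = vec-ext _ _ (λ x → trans (VecP.lookup∘tabulate _ x) (join-ι₁ W₁ X x))

    restrict₂-join : ∀ W₁ X → avoids F₂ X ≡ true → restrict₂ (join W₁ X) ≡ X
    restrict₂-join W₁ X a = vec-ext _ _ (λ y → trans (VecP.lookup∘tabulate _ y) (pointwise y))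
      where
      pointwise : ∀ y → lookup (join W₁ X) (ι₂ y) ∧ not (lookup F₂ y) ≡ lookup X y
      pointwise y with lookup F₂ y in f
      ... | true  = trans (BP.∧-zeroʳ _) (sym (avoids-sound F₂ X a y f))
      ... | false = trans (BP.∧-identityʳ _) (join-ι₂ W₁ X y f)

    join-restrict : ∀ W → join (preimage ι₁ W) (restrict₂ W) ≡ W
    join-restrict W = vec-ext _ _ (λ v → trans (VecP.lookup∘tabulate _ v) (pointwise v (pre₁ v) (pre₂ v)))
      where
      pointwise : ∀ v d₁ d₂ → choose (preimage ι₁ W) (restrict₂ W) d₁ d₂ ≡ lookup W v
      pointwise v (yes (x , e)) d₂ = trans (VecP.lookup∘tabulate _ x) (cong (lookup W) e)
      pointwise v (no ¬e) (yes (y , e)) = trans (VecP.lookup∘tabulate _ y)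
          (trans (cong (_∧_ (lookup W (ι₂ y))) outside-F₂) (trans (BP.∧-identityʳ _) (cong (lookup W) e)))
        where
        outside-F₂ : not (lookup F₂ y) ≡ true
        outside-F₂ with lookup F₂ y in f
        ... | false = refl
        ... | true  = let (x , e′) = glue₂ y f in ⊥-elim (¬e (x , trans (sym e′) e))
      pointwise v (no ¬e₁) (no ¬e₂) with cover v
      ... | inj₁ p = ⊥-elim (¬e₁ p)
      ... | inj₂ p = ⊥-elim (¬e₂ p)

    restrict₂-avoids : ∀ W → avoids F₂ (restrict₂ W) ≡ true
    restrict₂-avoids W = avoids-complete F₂ (restrict₂ W) (λ y f → trans (VecP.lookup∘tabulate _ y)
      (trans (cong (λ b → lookup W (ι₂ y) ∧ not b) f) (BP.∧-zeroʳ _)))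

    onFirst : Fin m → Bool
    onFirst v = ⌊ pre₁ v ⌋

    onFirst-elim : ∀ v → onFirst v ≡ true → ∃ λ x → ι₁ x ≡ v
    onFirst-elim v e with pre₁ v
    ... | yes p = p

    onFirst-intro : ∀ x → onFirst (ι₁ x) ≡ true
    onFirst-intro x with pre₁ (ι₁ x)
    ... | yes _ = refl
    ... | no ¬p = ⊥-elim (¬p (x , refl))

    Σ-vertices : ∀ (f : Fin m → ℤ) →
      Σ (allFin m) f ≡ Σ (allFin n₁) (λ x → f (ι₁ x)) + Σ (allFin n₂) (λ y → not (lookup F₂ y) ⇒ f (ι₂ y))
    Σ-vertices f = trans (Σ-cong (allFin m) (λ v → split⇒ (onFirst v) (f v)))
                   (trans (Σ-+ (allFin m) _ _) (sym (cong₂ _+_ first-side second-side)))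
      where
      first-side : Σ (allFin n₁) (λ x → true ⇒ f (ι₁ x)) ≡ Σ (allFin m) (λ v → onFirst v ⇒ f v)
      first-side = Σ-matching (allFin n₁) (allFin m) (allFin⁺ n₁) (allFin⁺ m) (λ _ → true) onFirst
        (λ x v → ⌊ ι₁ x Fin.≟ v ⌋) (λ x → f (ι₁ x)) f
        (λ x _ _ → ι₁ x , ∈-allFin _ , ≟-refl _ , λ v′ _ r → sym (≟-true _ _ r))
        (λ v _ q → let (x , e) = onFirst-elim v q in
           x , ∈-allFin x , subst (λ z → ⌊ ι₁ x Fin.≟ z ⌋ ≡ true) e (≟-refl _) ,
           λ x′ _ r → ι₁-inj (trans (≟-true _ _ r) (sym e)))
        (λ x v r → refl , subst (λ z → onFirst z ≡ true) (≟-true _ _ r) (onFirst-intro x) , cong f (≟-true _ _ r))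
      Rel : Fin n₂ → Fin m → Bool
      Rel y v = not (lookup F₂ y) ∧ ⌊ ι₂ y Fin.≟ v ⌋
      not-onFirst : ∀ y → lookup F₂ y ≡ false → not (onFirst (ι₂ y)) ≡ true
      not-onFirst y f with onFirst (ι₂ y) in e
      ... | false = refl
      ... | true  = let (x , e′) = onFirst-elim _ e in ⊥-elim (t≢f (trans (sym (meet₂ x y e′)) f))
      preimage₂ : ∀ v → v ∈ allFin m → not (onFirst v) ≡ true →
        ∃[ y ] (y ∈ allFin n₂ × Rel y v ≡ true × (∀ y′ → y′ ∈ allFin n₂ → Rel y′ v ≡ true → y′ ≡ y))
      preimage₂ v _ q with cover v
      ... | inj₁ (x , e) = ⊥-elim (t≢f (trans (sym (subst (λ z → onFirst z ≡ true) e (onFirst-intro x))) (not-true q)))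
      ... | inj₂ (y , refl) = y , ∈-allFin y , related ,
                              λ y′ _ r → ι₂-inj (≟-true _ _ (proj₂ (∧-elim {not (lookup F₂ y′)} r)))
        where
        related : Rel y (ι₂ y) ≡ true
        related with lookup F₂ y in fy
        ... | false = ≟-refl _
        ... | true  = let (x , e′) = glue₂ y fy in
                      ⊥-elim (t≢f (trans (sym (subst (λ z → onFirst z ≡ true) (sym e′) (onFirst-intro x))) (not-true q)))
      second-side : Σ (allFin n₂) (λ y → not (lookup F₂ y) ⇒ f (ι₂ y)) ≡ Σ (allFin m) (λ v → not (onFirst v) ⇒ f v)
      second-side = Σ-matching (allFin n₂) (allFin m) (allFin⁺ n₂) (allFin⁺ m)
        (λ y → not (lookup F₂ y)) (λ v → not (onFirst v)) Rel (λ y → f (ι₂ y)) f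
        (λ y _ p → ι₂ y , ∈-allFin _ , ∧-intro p (≟-refl _) , λ v′ _ r → sym (≟-true _ _ (proj₂ (∧-elim r))))
        preimage₂
        (λ y v r → let (p , q) = ∧-elim {not (lookup F₂ y)} r ; e = ≟-true _ _ q in
           p , subst (λ z → not (onFirst z) ≡ true) e (not-onFirst y (not-true p)) , cong f e)

    card-join : ∀ W₁ X → avoids F₂ X ≡ true → ∣ join W₁ X ∣ ≡ ∣ W₁ ∣ ℕ.+ ∣ X ∣
    card-join W₁ X a = ℤP.+-injective (begin
      + ∣ join W₁ X ∣ ≡⟨ card-Σ (join W₁ X) ⟩
      Σ (allFin m) (λ v → 𝟙 (lookup (join W₁ X) v)) ≡⟨ Σ-vertices _ ⟩
      Σ (allFin n₁) (λ x → 𝟙 (lookup (join W₁ X) (ι₁ x)))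
        + Σ (allFin n₂) (λ y → not (lookup F₂ y) ⇒ 𝟙 (lookup (join W₁ X) (ι₂ y)))
        ≡⟨ cong₂ _+_ (Σ-cong (allFin n₁) (λ x → cong 𝟙 (join-ι₁ W₁ X x))) (Σ-cong (allFin n₂) second) ⟩
      Σ (allFin n₁) (λ x → 𝟙 (lookup W₁ x)) + Σ (allFin n₂) (λ y → 𝟙 (lookup X y))
        ≡⟨ sym (cong₂ _+_ (card-Σ W₁) (card-Σ X)) ⟩
      + ∣ W₁ ∣ + + ∣ X ∣ ≡⟨ sym (ℤP.pos-+ ∣ W₁ ∣ ∣ X ∣) ⟩
      + (∣ W₁ ∣ ℕ.+ ∣ X ∣) ∎)
      where
      open ≡-Reasoning
      second : ∀ y → (not (lookup F₂ y) ⇒ 𝟙 (lookup (join W₁ X) (ι₂ y))) ≡ 𝟙 (lookup X y)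
      second y with lookup F₂ y in f
      ... | true  = cong 𝟙 (sym (avoids-sound F₂ X a y f))
      ... | false = cong 𝟙 (join-ι₂ W₁ X y f)

    Σ-subsets-as-pairs : ∀ (h : Subset m → ℤ) →
      Σ (allSubsets m) h ≡ Σ (allSubsets n₁) (λ W₁ → Σ (allSubsets n₂) (λ X → avoids F₂ X ⇒ h (join W₁ X)))
    Σ-subsets-as-pairs h = sym (trans
      (sym (Σ-cartesianProduct (allSubsets n₁) (allSubsets n₂) (λ p → avoids F₂ (proj₂ p) ⇒ h (join (proj₁ p) (proj₂ p)))))
      (Σ-matching (cartesianProduct (allSubsets n₁) (allSubsets n₂)) (allSubsets m)
          (cartesianProduct⁺ (allSubsets-unique n₁) (allSubsets-unique n₂)) (allSubsets-unique m)
          (λ p → avoids F₂ (proj₂ p)) (λ _ → true) Rel (λ p → h (join (proj₁ p) (proj₂ p))) h hx hy hR))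
      where
      _≟S_ : ∀ {k} (U V : Subset k) → Dec (U ≡ V)
      _≟S_ = VecP.≡-dec BP._≟_
      ≟S-true : ∀ {k} (U V : Subset k) → ⌊ U ≟S V ⌋ ≡ true → U ≡ V
      ≟S-true U V e with U ≟S V
      ... | yes p = p
      ≟S-refl : ∀ {k} (U : Subset k) → ⌊ U ≟S U ⌋ ≡ true
      ≟S-refl U with U ≟S U
      ... | yes _ = refl
      ... | no ¬p = ⊥-elim (¬p refl)
      Rel : Subset n₁ × Subset n₂ → Subset m → Bool
      Rel (A , B) W = avoids F₂ B ∧ ⌊ join A B ≟S W ⌋
      hx : ∀ p → p ∈ cartesianProduct (allSubsets n₁) (allSubsets n₂) → avoids F₂ (proj₂ p) ≡ true →
           ∃[ W ] (W ∈ allSubsets m × Rel p W ≡ true × (∀ W′ → W′ ∈ allSubsets m → Rel p W′ ≡ true → W′ ≡ W))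
      hx (A , B) _ a = join A B , ∈-allSubsets _ , ∧-intro a (≟S-refl _) ,
                       λ W′ _ r → sym (≟S-true _ _ (proj₂ (∧-elim {avoids F₂ B} r)))
      hy : ∀ W → W ∈ allSubsets m → true ≡ true →
           ∃[ p ] (p ∈ cartesianProduct (allSubsets n₁) (allSubsets n₂) × Rel p W ≡ true ×
                   (∀ p′ → p′ ∈ cartesianProduct (allSubsets n₁) (allSubsets n₂) → Rel p′ W ≡ true → p′ ≡ p))
      hy W _ _ = (preimage ι₁ W , restrict₂ W) , ∈-cartesianProduct⁺ (∈-allSubsets _) (∈-allSubsets _) ,
                 ∧-intro (restrict₂-avoids W)
                   (subst (λ z → ⌊ join (preimage ι₁ W) (restrict₂ W) ≟S z ⌋ ≡ true) (join-restrict W) (≟S-refl _)) ,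
                 λ { (A , B) _ r → let (a , q) = ∧-elim {avoids F₂ B} r ; e = ≟S-true _ _ q in
                       cong₂ _,_ (trans (sym (preimage-join A B)) (cong (preimage ι₁) e))
                                 (trans (sym (restrict₂-join A B a)) (cong restrict₂ e)) }
      hR : ∀ p W → Rel p W ≡ true → avoids F₂ (proj₂ p) ≡ true × true ≡ true × h (join (proj₁ p) (proj₂ p)) ≡ h W
      hR (A , B) W r = let (a , q) = ∧-elim {avoids F₂ B} r in a , refl , cong h (≟S-true _ _ q)

module Summation where

  open Sums
  open Subsets
  open ConnectedSum
  open ComponentCount
  open Reindex
  open import Defs hiding (sym)
  open import Data.Bool using (Bool; true; false)
  import Data.Bool.Properties as BP
  open import Function.Bundles using (Equivalence; mk⇔)
  open import Data.Nat as ℕ using (ℕ; zero; suc; _∸_; _≡ᵇ_; _≤ᵇ_)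
  import Data.Nat.Properties as ℕP
  open import Data.Nat.Combinatorics using (_C_)
  open import Data.Integer as ℤ using (ℤ; +_; _+_; _*_)
  import Data.Integer.Properties as ℤP
  open import Data.Fin using (Fin)
  open import Data.Fin.Subset using (Subset; ∣_∣)
  open import Data.Fin.Subset.Properties using (∣p∣≤n)
  open import Data.List using (List)
  open import Relation.Nullary using (¬_; yes; no)
  open import Relation.Binary using (tri<; tri≈; tri>)
  open import Relation.Binary.PropositionalEquality
  open import Data.Empty using (⊥-elim)
  open import Data.Integer.Tactic.RingSolver

  sizeSum : ∀ m → ℕ → (Subset m → ℤ) → ℤ
  sizeSum m k h = Σ (allSubsets m) (λ W → (∣ W ∣ ≡ᵇ k) ⇒ h W)

  b-sizeSum : ∀ {n} (k : ℕ) (H : Graph n) → b k H ≡ sizeSum n k (d H)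
  b-sizeSum {n} k H = trans (foldr-filter (λ W → ∣ W ∣ ℕ.≟ k) (d H) (allSubsets n))
    (Σ-cong (allSubsets n) (λ W → cong (λ z → z ⇒ d H W) (isYes≡ᵇ ∣ W ∣ k (∣ W ∣ ℕ.≟ k))))

  sumTo-cong : ∀ k {f g : ℕ → ℤ} → (∀ i → f i ≡ g i) → sumTo k f ≡ sumTo k g
  sumTo-cong zero    e = e 0
  sumTo-cong (suc k) e = cong₂ _+_ (sumTo-cong k e) (e (suc k))

  sumTo-+ : ∀ k (f g : ℕ → ℤ) → sumTo k (λ i → f i + g i) ≡ sumTo k f + sumTo k g
  sumTo-+ zero    f g = refl
  sumTo-+ (suc k) f g = trans (cong (_+ (f (suc k) + g (suc k))) (sumTo-+ k f g))
                              (swap4 (sumTo k f) (sumTo k g) (f (suc k)) (g (suc k)))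
    where
    swap4 : ∀ a b c d → (a + b) + (c + d) ≡ (a + c) + (b + d)
    swap4 = solve-∀

  sumTo-Σ : ∀ {X : Set} k (xs : List X) (f : ℕ → X → ℤ) →
            sumTo k (λ i → Σ xs (f i)) ≡ Σ xs (λ x → sumTo k (λ i → f i x))
  sumTo-Σ zero    xs f = refl
  sumTo-Σ (suc k) xs f = trans (cong (_+ Σ xs (f (suc k))) (sumTo-Σ k xs f)) (sym (Σ-+ xs _ _))

  ≤ᵇ-true : ∀ {a k} → a ℕ.≤ k → (a ≤ᵇ k) ≡ true
  ≤ᵇ-true le = Equivalence.to BP.T-≡ (ℕP.≤⇒≤ᵇ le)

  ≤ᵇ-false : ∀ {a k} → ¬ (a ℕ.≤ k) → (a ≤ᵇ k) ≡ false
  ≤ᵇ-false {a} {k} nle with a ≤ᵇ k in e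
  ... | false = refl
  ... | true  = ⊥-elim (nle (ℕP.≤ᵇ⇒≤ a k (Equivalence.from BP.T-≡ e)))

  sumTo-delta : ∀ k a (F : ℕ → ℤ) → sumTo k (λ i → (a ≡ᵇ i) ⇒ F i) ≡ (a ≤ᵇ k) ⇒ F a
  sumTo-delta zero zero    F = refl
  sumTo-delta zero (suc a) F = refl
  sumTo-delta (suc k) a F with ℕP.<-cmp a (suc k)
  ... | tri< lt ne _
        rewrite sumTo-delta k a F | ≤ᵇ-true (ℕ.s≤s⁻¹ lt) | ≡ᵇ-false a (suc k) ne
              | ≤ᵇ-true {a} {suc k} (ℕP.<⇒≤ lt) = ℤP.+-identityʳ _
  ... | tri≈ _ refl _
        rewrite sumTo-delta k (suc k) F | ≤ᵇ-false {suc k} {k} (ℕP.<⇒≱ ℕP.≤-refl) | ≡ᵇ-refl k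
              | ≤ᵇ-true {suc k} {suc k} ℕP.≤-refl = ℤP.+-identityˡ _
  ... | tri> _ ne gt
        rewrite sumTo-delta k a F | ≤ᵇ-false {a} {k} (ℕP.<⇒≱ (ℕP.<-trans (ℕP.n<1+n k) gt))
              | ≡ᵇ-false a (suc k) ne | ≤ᵇ-false {a} {suc k} (ℕP.<⇒≱ gt) = refl

  ⇒-*-𝟙 : ∀ b v e D → ((b ⇒ D) * (v ⇒ 𝟙 e)) ≡ b ⇒ (v ⇒ (e ⇒ D))
  ⇒-*-𝟙 false v e D = refl
  ⇒-*-𝟙 true false e D = ℤP.*-zeroʳ D
  ⇒-*-𝟙 true true true D = ℤP.*-identityʳ D
  ⇒-*-𝟙 true true false D = ℤP.*-zeroʳ D

  convolution-term : ∀ k a c v D →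
    sumTo k (λ i → ((a ≡ᵇ i) ⇒ D) * (v ⇒ 𝟙 (c ≡ᵇ (k ∸ i)))) ≡ v ⇒ (((a ℕ.+ c) ≡ᵇ k) ⇒ D)
  convolution-term k a c v D = trans (sumTo-cong k (λ i → ⇒-*-𝟙 (a ≡ᵇ i) v (c ≡ᵇ (k ∸ i)) D))
    (trans (sumTo-delta k a (λ i → v ⇒ ((c ≡ᵇ (k ∸ i)) ⇒ D))) sizes-match)
    where
    sizes-match : (a ≤ᵇ k) ⇒ (v ⇒ ((c ≡ᵇ (k ∸ a)) ⇒ D)) ≡ v ⇒ (((a ℕ.+ c) ≡ᵇ k) ⇒ D)
    sizes-match with a ℕP.≤? k
    ... | yes le rewrite ≤ᵇ-true le =
          cong (λ z → v ⇒ (z ⇒ D)) (BP.⇔→≡ {z = true} (mk⇔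
            (λ e → subst (λ z → (a ℕ.+ z ≡ᵇ k) ≡ true) (sym (≡ᵇ-true _ _ e))
                     (subst (λ z → (z ≡ᵇ k) ≡ true) (sym (ℕP.m+[n∸m]≡n le)) (≡ᵇ-refl k)))
            (λ e → subst (λ z → (c ≡ᵇ (z ∸ a)) ≡ true) (≡ᵇ-true _ _ e)
                     (subst (λ z → (c ≡ᵇ z) ≡ true) (sym (ℕP.m+n∸m≡n a c)) (≡ᵇ-refl c)))))
    ... | no nle rewrite ≤ᵇ-false nle
          | ≡ᵇ-false (a ℕ.+ c) k (λ e → nle (subst (a ℕ.≤_) e (ℕP.m≤m+n a c))) = sym (⇒0 v)

  module Terms {n₁ n₂ m : ℕ} {G₁ : Graph n₁} {G₂ : Graph n₂} {G : Graph m}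
      {F₁ : Subset n₁} {F₂ : Subset n₂} {ι₁ : Fin n₁ → Fin m} {ι₂ : Fin n₂ → Fin m}
      (S : Setup G₁ G₂ G F₁ F₂ ι₁ ι₂) where
    open Reindex.Reindex S

    sizeSum-preimage : ∀ k (h : Subset n₁ → ℤ) →
      sizeSum m k (λ W → h (preimage ι₁ W)) ≡
      Σ (allSubsets n₁) (λ W₁ → Σ (allSubsets n₂) (λ X → avoids F₂ X ⇒ (((∣ W₁ ∣ ℕ.+ ∣ X ∣) ≡ᵇ k) ⇒ h W₁)))
    sizeSum-preimage k h = trans (Σ-subsets-as-pairs _)
      (Σ-cong (allSubsets n₁) (λ W₁ → Σ-cong (allSubsets n₂) (λ X → pair-term W₁ X)))
      where
      pair-term : ∀ W₁ X → (avoids F₂ X ⇒ ((∣ join W₁ X ∣ ≡ᵇ k) ⇒ h (preimage ι₁ (join W₁ X))))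
                         ≡ (avoids F₂ X ⇒ (((∣ W₁ ∣ ℕ.+ ∣ X ∣) ≡ᵇ k) ⇒ h W₁))
      pair-term W₁ X with avoids F₂ X in a
      ... | false = refl
      ... | true rewrite card-join W₁ X a | preimage-join W₁ X = refl

    first-side-term : ∀ t → ∣ F₂ ∣ ≡ t → ∀ k →
      sizeSum m k (λ W → d G₁ (preimage ι₁ W)) ≡ sumTo k (λ i → b i G₁ * + ((n₂ ∸ t) C (k ∸ i)))
    first-side-term t card k = trans (sizeSum-preimage k (d G₁)) (sym (begin
      sumTo k (λ i → b i G₁ * + ((n₂ ∸ t) C (k ∸ i)))
        ≡⟨ sumTo-cong k (λ i → cong₂ _*_ (b-sizeSum i G₁)
             (trans (cong (λ z → + ((n₂ ∸ z) C (k ∸ i))) (sym card)) (sym (count-avoiding n₂ F₂ (k ∸ i))))) ⟩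
      sumTo k (λ i → sizeSum n₁ i (d G₁) * Σ (allSubsets n₂) (λ X → avoids F₂ X ⇒ 𝟙 (∣ X ∣ ≡ᵇ (k ∸ i))))
        ≡⟨ sumTo-cong k (λ i → Σ-prod (allSubsets n₁) (allSubsets n₂) _ _) ⟩
      sumTo k (λ i → Σ (allSubsets n₁) (λ W₁ → Σ (allSubsets n₂) (λ X → term i W₁ X)))
        ≡⟨ sumTo-Σ k (allSubsets n₁) _ ⟩
      Σ (allSubsets n₁) (λ W₁ → sumTo k (λ i → Σ (allSubsets n₂) (λ X → term i W₁ X)))
        ≡⟨ Σ-cong (allSubsets n₁) (λ W₁ → sumTo-Σ k (allSubsets n₂) _) ⟩
      Σ (allSubsets n₁) (λ W₁ → Σ (allSubsets n₂) (λ X → sumTo k (λ i → term i W₁ X)))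
        ≡⟨ Σ-cong (allSubsets n₁) (λ W₁ → Σ-cong (allSubsets n₂) (λ X →
             convolution-term k ∣ W₁ ∣ ∣ X ∣ (avoids F₂ X) (d G₁ W₁))) ⟩
      Σ (allSubsets n₁) (λ W₁ → Σ (allSubsets n₂) (λ X → avoids F₂ X ⇒ (((∣ W₁ ∣ ℕ.+ ∣ X ∣) ≡ᵇ k) ⇒ d G₁ W₁))) ∎))
      where
      open ≡-Reasoning
      term : ℕ → Subset n₁ → Subset n₂ → ℤ
      term i W₁ X = ((∣ W₁ ∣ ≡ᵇ i) ⇒ d G₁ W₁) * (avoids F₂ X ⇒ 𝟙 (∣ X ∣ ≡ᵇ (k ∸ i)))

    avoiding-term : ∀ k →
      sizeSum m k (λ W → 𝟙 (avoids F₁ (preimage ι₁ W))) ≡ + (((n₁ ∸ ∣ F₁ ∣) ℕ.+ (n₂ ∸ ∣ F₂ ∣)) C k)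
    avoiding-term k = trans (sizeSum-preimage k (λ W₁ → 𝟙 (avoids F₁ W₁)))
      (trans (Σ-cong (allSubsets n₁) (λ W₁ → Σ-cong (allSubsets n₂) (λ X →
                guards-commute (avoids F₂ X) (avoids F₁ W₁) ((∣ W₁ ∣ ℕ.+ ∣ X ∣) ≡ᵇ k))))
             (count-avoiding-pairs n₁ F₁ n₂ F₂ k))
      where
      guards-commute : ∀ a₂ a₁ e → (a₂ ⇒ (e ⇒ 𝟙 a₁)) ≡ (a₁ ⇒ a₂ ⇒ 𝟙 e)
      guards-commute true  true  e = refl
      guards-commute true  false e = ⇒0 e
      guards-commute false a₁    e = sym (⇒0 a₁)

  b-split : ∀ {n₁ n₂ m : ℕ} {G₁ : Graph n₁} {G₂ : Graph n₂} {G : Graph m}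
      {F₁ : Subset n₁} {F₂ : Subset n₂} {ι₁ : Fin n₁ → Fin m} {ι₂ : Fin n₂ → Fin m} →
      Setup G₁ G₂ G F₁ F₂ ι₁ ι₂ → ∀ k →
      b k G ≡ (sizeSum m k (λ W → d G₁ (preimage ι₁ W)) + sizeSum m k (λ W → d G₂ (preimage ι₂ W)))
              + sizeSum m k (λ W → 𝟙 (avoids F₂ (preimage ι₂ W)))
  b-split {m = m} {G₁} {G₂} {G} {F₂ = F₂} {ι₁} {ι₂} S k = begin
    b k G ≡⟨ b-sizeSum k G ⟩
    sizeSum m k (d G)
      ≡⟨ Σ-cong (allSubsets m) (λ W → cong ((∣ W ∣ ≡ᵇ k) ⇒_) (Count.d-glue S W)) ⟩
    sizeSum m k (λ W → (D₁ W + D₂ W) + A W)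
      ≡⟨ Σ-cong (allSubsets m) (λ W → trans (⇒-+ (∣ W ∣ ≡ᵇ k) _ _) (cong (_+ ((∣ W ∣ ≡ᵇ k) ⇒ A W)) (⇒-+ (∣ W ∣ ≡ᵇ k) _ _))) ⟩
    Σ (allSubsets m) (λ W → (((∣ W ∣ ≡ᵇ k) ⇒ D₁ W) + ((∣ W ∣ ≡ᵇ k) ⇒ D₂ W)) + ((∣ W ∣ ≡ᵇ k) ⇒ A W))
      ≡⟨ trans (Σ-+ (allSubsets m) _ _) (cong (_+ sizeSum m k A) (Σ-+ (allSubsets m) _ _)) ⟩
    (sizeSum m k D₁ + sizeSum m k D₂) + sizeSum m k A ∎
    where
    open ≡-Reasoning
    D₁ D₂ A : Subset m → ℤ
    D₁ W = d G₁ (preimage ι₁ W)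
    D₂ W = d G₂ (preimage ι₂ W)
    A W = 𝟙 (avoids F₂ (preimage ι₂ W))

  clique-complements : ∀ {n₁ n₂} (F₁ : Subset n₁) (F₂ : Subset n₂) t → ∣ F₁ ∣ ≡ t → ∣ F₂ ∣ ≡ t →
    (n₂ ∸ ∣ F₂ ∣) ℕ.+ (n₁ ∸ ∣ F₁ ∣) ≡ n₁ ℕ.+ n₂ ∸ 2 ℕ.* t
  clique-complements {n₁} {n₂} F₁ F₂ t card₁ card₂ = sym (begin
    n₁ ℕ.+ n₂ ∸ 2 ℕ.* t             ≡⟨ cong (n₁ ℕ.+ n₂ ∸_) (cong (ℕ._+_ t) (ℕP.+-identityʳ t)) ⟩
    n₁ ℕ.+ n₂ ∸ (t ℕ.+ t)            ≡⟨ sym (ℕP.∸-+-assoc (n₁ ℕ.+ n₂) t t) ⟩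
    (n₁ ℕ.+ n₂ ∸ t) ∸ t              ≡⟨ cong (_∸ t) (ℕP.+-∸-comm n₂ t≤n₁) ⟩
    ((n₁ ∸ t) ℕ.+ n₂) ∸ t            ≡⟨ ℕP.+-∸-assoc (n₁ ∸ t) t≤n₂ ⟩
    (n₁ ∸ t) ℕ.+ (n₂ ∸ t)            ≡⟨ ℕP.+-comm (n₁ ∸ t) (n₂ ∸ t) ⟩
    (n₂ ∸ t) ℕ.+ (n₁ ∸ t)            ≡⟨ cong₂ (λ a c → (n₂ ∸ a) ℕ.+ (n₁ ∸ c)) (sym card₂) (sym card₁) ⟩
    (n₂ ∸ ∣ F₂ ∣) ℕ.+ (n₁ ∸ ∣ F₁ ∣) ∎)
    where
    open ≡-Reasoning
    t≤n₁ : t ℕ.≤ n₁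
    t≤n₁ = subst (ℕ._≤ n₁) card₁ (∣p∣≤n F₁)
    t≤n₂ : t ℕ.≤ n₂
    t≤n₂ = subst (ℕ._≤ n₂) card₂ (∣p∣≤n F₂)

open Sums using (𝟙)
open Subsets using (avoids; preimage)
open ConnectedSum using (swapS; module FromIsConnectedSum)
open ComponentCount using (d)
open Summation
open import Defs
open import Data.Nat using (ℕ; _+_; _∸_; _≥_; _*_)
open import Data.Nat.Combinatorics using (_C_)
open import Data.Fin using (Fin)
open import Data.Fin.Subset using (Subset)
open import Data.Integer as ℤ using (ℤ; +_)
open import Relation.Binary.PropositionalEquality hiding (sym)
import Relation.Binary.PropositionalEquality as Eq

-- The argument does not use t ≥ 1: for t = 0 it gives the formula for the
-- disjoint union.
theorem3p2 : ∀ {n₁ n₂ m : ℕ} (t : ℕ) → t ≥ 1 →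
    (G₁ : Graph n₁) (G₂ : Graph n₂) (G : Graph m)
    (F₁ : Subset n₁) (F₂ : Subset n₂)
    (ι₁ : Fin n₁ → Fin m) (ι₂ : Fin n₂ → Fin m) →
    IsConnectedSum t G₁ G₂ G F₁ F₂ ι₁ ι₂ →
    (k : ℕ) →
    b k G ≡ sumTo k (λ i → b i G₁ ℤ.* (+ ((n₂ ∸ t) C (k ∸ i)))
                         ℤ.+ b i G₂ ℤ.* (+ ((n₁ ∸ t) C (k ∸ i))))
            ℤ.+ (+ ((n₁ + n₂ ∸ 2 * t) C k))
theorem3p2 {n₁} {n₂} {m} t _ G₁ G₂ G F₁ F₂ ι₁ ι₂ CS k = begin
  b k G
    ≡⟨ b-split S k ⟩
  (sizeSum m k (λ W → d G₁ (preimage ι₁ W)) ℤ.+ sizeSum m k (λ W → d G₂ (preimage ι₂ W)))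
    ℤ.+ sizeSum m k (λ W → 𝟙 (avoids F₂ (preimage ι₂ W)))
    ≡⟨ cong₂ ℤ._+_ (cong₂ ℤ._+_ (Terms.first-side-term S t card₂ k) (Terms.first-side-term (swapS S) t card₁ k))
                   (trans (Terms.avoiding-term (swapS S) k) (cong (λ N → + (N C k)) (clique-complements F₁ F₂ t card₁ card₂))) ⟩
  (sumTo k (λ i → b i G₁ ℤ.* (+ ((n₂ ∸ t) C (k ∸ i)))) ℤ.+ sumTo k (λ i → b i G₂ ℤ.* (+ ((n₁ ∸ t) C (k ∸ i)))))
    ℤ.+ (+ ((n₁ + n₂ ∸ 2 * t) C k))
    ≡⟨ cong (ℤ._+ (+ ((n₁ + n₂ ∸ 2 * t) C k))) (Eq.sym (sumTo-+ k _ _)) ⟩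
  sumTo k (λ i → b i G₁ ℤ.* (+ ((n₂ ∸ t) C (k ∸ i))) ℤ.+ b i G₂ ℤ.* (+ ((n₁ ∸ t) C (k ∸ i))))
    ℤ.+ (+ ((n₁ + n₂ ∸ 2 * t) C k)) ∎
  where
  open ≡-Reasoning
  open IsConnectedSum CS using (card₁; card₂)
  S : ConnectedSum.Setup G₁ G₂ G F₁ F₂ ι₁ ι₂
  S = FromIsConnectedSum.toSetup CS
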